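{- Let $G$ be a finite group with $G=G_1G_2$, where $G_1,G_2$ are proper subgroups of $G$ (not necessarily normal), and let $N=G_1\cap G_2$. Suppose that $X_1\subseteq G_1$ and $X_2\subseteq G_2$ are semiregular relative difference sets in $G_1$ and $G_2$, respectively, both with forbidden subgroup $N$, with parameters $(n\lambda_1,n,n\lambda_1,\lambda_1)$ and $(n\lambda_2,n,n\lambda_2,\lambda_2)$, respectively. If $X_1$ is i-commuting, then $X_1X_2$ is a semiregular relative difference set in $G$ with forbidden subgroup $N$ and parameters $(n^2\lambda_1\lambda_2,n,n^2\lambda_1\lambda_2,n\lambda_1\lambda_2)$. Moreover, $X_1X_2$ is symmetric if and only if $X_2$ is symmetric.
   Context: For a finite group $G$ and $X\subseteq G$, write $\underline{X}=\sum_{x\in X}x\in\mathbb{Z}G$ and $X^{(-1)}=\{x^{ -1}:x\in X\}$; $e$ is the identity. For $N\leq G$, $X\subseteq G$ is a relative difference set (RDS) relative to $N$ (forbidden subgroup $N$) with parameters $(m,n,k,\lambda)$ if $\underline{X}\cdot\underline{X^{(-1)}}=ke+\lambda(\underline{G}-\underline{N})$, where $k=|X|$, $m=|G:N|$, $n=|N|$, $\lambda$ a positive integer. It is semiregular if $|X\cap Ng|=1$ for all $g\in G$. $X$ is i-commuting if $\underline{X}\cdot\underline{X^{(-1)}}=\underline{X^{(-1)}}\cdot\underline{X}$. An RDS $X$ is symmetric if $X^{(-1)}$ is also an RDS with the same parameters (possibly with a different forbidden subgroup). -}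

module Defs where

open import Level using (0ℓ)
open import Data.Nat as ℕ using (ℕ; _>_)
open import Data.Integer as ℤ using (ℤ; +_; 0ℤ; 1ℤ)
open import Data.Bool using (Bool; true; false; if_then_else_; _∧_)
open import Data.Fin using (Fin; _≟_)
open import Data.Fin.Subset using (Subset; _∈_; _∉_; _⊆_; _∩_; ∣_∣; ⊤)
open import Data.Vec using (lookup; tabulate)
open import Data.List using (List; foldr; map; allFin)
open import Data.Bool.ListAction using (any)
open import Data.Product using (Σ; ∃; _×_; _,_)
open import Relation.Binary.PropositionalEquality using (_≡_)
open import Relation.Nullary.Decidable using (⌊_⌋)
open import Algebra.Structures using (IsGroup)

-- A finite group, presented (up to isomorphism) on the carrier Fin order,
-- with propositional equality.
record FinGroup : Set where
  field
    order : ℕ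
    _∙_   : Fin order → Fin order → Fin order
    ε     : Fin order
    _⁻¹   : Fin order → Fin order
    isGroup : IsGroup _≡_ _∙_ ε _⁻¹

module _ (𝔾 : FinGroup) where
  open FinGroup 𝔾

  Elt : Set
  Elt = Fin order

  Sub : Set
  Sub = Subset order

  record IsSubgroup (H : Sub) : Set where
    field
      ε∈     : ε ∈ H
      ∙-closed : ∀ {x y} → x ∈ H → y ∈ H → (x ∙ y) ∈ H
      ⁻¹-closed : ∀ {x} → x ∈ H → (x ⁻¹) ∈ H

  IsProper : Sub → Set
  IsProper H = ∃ λ g → g ∉ H

  inv : Sub → Sub
  inv X = tabulate λ g → lookup X (g ⁻¹)

  prodSet : Sub → Sub → Sub
  prodSet X Y = tabulate λ g → any (λ x → lookup X x ∧ lookup Y ((x ⁻¹) ∙ g)) (allFin order)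

  -- right coset N g = { h g : h ∈ N }, i.e. { h' : h' g⁻¹ ∈ N }
  coset : Sub → Elt → Sub
  coset N g = tabulate λ h → lookup N (h ∙ (g ⁻¹))

  -- The integral group ring ℤG, elements as coefficient functions
  ZG : Set
  ZG = Elt → ℤ

  Σ[g] : (Elt → ℤ) → ℤ
  Σ[g] f = foldr ℤ._+_ 0ℤ (map f (allFin order))

  infixl 7 _*ᴳ_ _·ᴳ_
  infixl 6 _+ᴳ_ _-ᴳ_

  _+ᴳ_ : ZG → ZG → ZG
  (a +ᴳ b) g = a g ℤ.+ b g

  _-ᴳ_ : ZG → ZG → ZG
  (a -ᴳ b) g = a g ℤ.- b g

  _·ᴳ_ : ℕ → ZG → ZG
  (k ·ᴳ a) g = (+ k) ℤ.* a g

  _*ᴳ_ : ZG → ZG → ZG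
  (a *ᴳ b) g = Σ[g] λ h → a h ℤ.* b ((h ⁻¹) ∙ g)

  eᴳ : ZG
  eᴳ g = if ⌊ g ≟ ε ⌋ then 1ℤ else 0ℤ

  ⟦_⟧ : Sub → ZG
  ⟦ X ⟧ g = if lookup X g then 1ℤ else 0ℤ

  _≈ᴳ_ : ZG → ZG → Set
  a ≈ᴳ b = ∀ g → a g ≡ b g

  -- X ⊆ H is an RDS in the (sub)group H relative to the forbidden subgroup
  -- N ≤ H with parameters (m,n,k,λ):  m = |H:N|, n = |N|, k = |X|, λ > 0,
  -- and  X X^{(-1)} = k e + λ (H − N)  in ℤG (⊇ ℤH).
  record IsRDS (H N X : Sub) (m n k l : ℕ) : Set where
    field
      H-subgroup : IsSubgroup H
      N-subgroup : IsSubgroup N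
      N⊆H        : N ⊆ H
      X⊆H        : X ⊆ H
      |N|≡n      : ∣ N ∣ ≡ n
      index≡m    : ∣ H ∣ ≡ m ℕ.* n
      |X|≡k      : ∣ X ∣ ≡ k
      l-pos      : l > 0
      equation   : (⟦ X ⟧ *ᴳ ⟦ inv X ⟧) ≈ᴳ (k ·ᴳ eᴳ +ᴳ l ·ᴳ (⟦ H ⟧ -ᴳ ⟦ N ⟧))

  IsSemiregular : (H N X : Sub) → Set
  IsSemiregular H N X = ∀ g → g ∈ H → ∣ X ∩ coset N g ∣ ≡ 1

  IsSemiregularRDS : (H N X : Sub) (m n k l : ℕ) → Set
  IsSemiregularRDS H N X m n k l = IsRDS H N X m n k l × IsSemiregular H N X

  IsICommuting : Sub → Set
  IsICommuting X = (⟦ X ⟧ *ᴳ ⟦ inv X ⟧) ≈ᴳ (⟦ inv X ⟧ *ᴳ ⟦ X ⟧)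

  IsSymmetricRDS : (H N X : Sub) (m n k l : ℕ) → Set
  IsSymmetricRDS H N X m n k l =
    IsRDS H N X m n k l × (∃ λ N′ → IsRDS H N′ (inv X) m n k l)

module Submission where

-- Everything is computed in the integral group ring ℤG, where a⁽⁻¹⁾ denotes the anti-involution
-- induced by g ↦ g⁻¹ and N, G₁, G₂, G, X₁, X₂ stand for the indicator elements.
--
-- An RDS X in H with parameters (nλ, n, nλ, λ) satisfies N X = H: for D = N X − H one computes
-- D D⁽⁻¹⁾ = 0 from X X⁽⁻¹⁾ = nλ e + λ (H − N), and the coefficient of e in D D⁽⁻¹⁾ is Σ D(g)².
-- This gives N X₂ = G₂, and, since i-commutativity makes X₁⁽⁻¹⁾ an RDS as well, X₁ N = G₁.
-- With G₁ G₂ = n G (as G = G₁ G₂) one gets X₁ G₂ = G₁ X₂ = G, and then for P = X₁ X₂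
--   P P⁽⁻¹⁾ = X₁ (k₂ e + λ₂ (G₂ − N)) X₁⁽⁻¹⁾ = K e + Λ (G − N),
--   P⁽⁻¹⁾ P = k₁ X₂⁽⁻¹⁾ X₂ + λ₁ k₂ (G − G₂),
-- with k_i = nλ_i, K = k₁k₂, Λ = nλ₁λ₂. Comparing Σ P with Σ P² = (P P⁽⁻¹⁾)(e) shows that P is the
-- indicator of the set X₁X₂. The right-hand side of the second identity is an injective affine
-- function of X₂⁽⁻¹⁾ X₂, so X₁X₂ is symmetric (with forbidden subgroup N′) exactly when X₂ is.

open import Level using (0ℓ)
open import Algebra.Bundles using (Group; AbelianGroup)
open import Algebra.Structures using (IsGroup)
import Algebra.Properties.Group as GroupProperties
open import Data.Bool using (Bool; true; false; if_then_else_; _∧_)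
open import Data.Bool.ListAction using (or)
import Data.Bool.Properties as Boolₚ
open import Data.Empty using (⊥-elim)
open import Data.Fin using (Fin; _≟_)
import Data.Fin as Fin
open import Data.Fin.Permutation using (permutation)
open import Data.Fin.Subset using (Subset; _∈_; _⊆_; _∩_; ∣_∣; ⊤)
import Data.Fin.Subset.Properties as Subsetₚ
import Data.Integer as ℤ
import Data.Integer.Properties as ℤₚ
open import Data.Integer.Tactic.RingSolver using (solve-∀)
import Data.List as List
import Data.List.Properties as Listₚ
open import Data.Nat as ℕ using (ℕ; zero; suc)
import Data.Nat.Properties as ℕₚ
open import Data.Product using (Σ; _×_; _,_)
open import Data.Sum using (_⊎_; inj₁; inj₂)
import Data.Sum as Sum
open import Data.Vec using ([]; _∷_; lookup)
import Data.Vec.Properties as Vecₚ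
open import Function using (_∘_)
open import Function.Bundles using (_⇔_; mk⇔; Equivalence)
open import Relation.Binary.Bundles using (Setoid)
open import Relation.Binary.PropositionalEquality
import Relation.Binary.Reasoning.Setoid as SetoidReasoning
open import Relation.Nullary using (¬_; yes; no)
open import Relation.Nullary.Decidable using (⌊_⌋)

open import Defs

∈⇔⇒lookup≡ : ∀ {n} (p : Subset n) {x y} → x ∈ p ⇔ y ∈ p → lookup p x ≡ lookup p y
∈⇔⇒lookup≡ p {x} {y} x∈⇔y∈ = Boolₚ.⇔→≡ (mk⇔
  (Vecₚ.[]=⇒lookup ∘ Equivalence.to x∈⇔y∈ ∘ Vecₚ.lookup⇒[]= x p)
  (Vecₚ.[]=⇒lookup ∘ Equivalence.from x∈⇔y∈ ∘ Vecₚ.lookup⇒[]= y p))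

module IntegerSums where
  open ℤ using (ℤ; +_; 0ℤ; 1ℤ; -_; _+_; _*_; _-_; _≤_)
  open import Algebra.Properties.Semiring.Sum ℤₚ.+-*-semiring public
    using (sum; sum-cong-≗; ∑-distrib-+; *-distribˡ-sum; *-distribʳ-sum; ∑-comm; sum-permute; sum-replicate-zero)

  sum-nonneg : ∀ {n} (f : Fin n → ℤ) → (∀ i → 0ℤ ≤ f i) → 0ℤ ≤ sum f
  sum-nonneg {zero}  f f≥0 = ℤₚ.≤-refl
  sum-nonneg {suc n} f f≥0 = ℤₚ.+-mono-≤ (f≥0 Fin.zero) (sum-nonneg (f ∘ Fin.suc) (f≥0 ∘ Fin.suc))

  nonneg+nonneg≡0 : ∀ {i j} → 0ℤ ≤ i → 0ℤ ≤ j → i + j ≡ 0ℤ → i ≡ 0ℤ × j ≡ 0ℤ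
  nonneg+nonneg≡0 (ℤ.+≤+ {n = m} _) (ℤ.+≤+ {n = k} _) i+j≡0 =
    cong +_ (ℕₚ.m+n≡0⇒m≡0 m m+k≡0) , cong +_ (ℕₚ.m+n≡0⇒n≡0 m m+k≡0)
    where
    m+k≡0 : m ℕ.+ k ≡ 0
    m+k≡0 = ℤₚ.+-injective (trans (ℤₚ.pos-+ m k) i+j≡0)

  sum-nonneg-≡0 : ∀ {n} (f : Fin n → ℤ) → (∀ i → 0ℤ ≤ f i) → sum f ≡ 0ℤ → ∀ i → f i ≡ 0ℤ
  sum-nonneg-≡0 {suc n} f f≥0 Σf≡0 i with nonneg+nonneg≡0 (f≥0 Fin.zero) (sum-nonneg (f ∘ Fin.suc) (f≥0 ∘ Fin.suc)) Σf≡0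
  sum-nonneg-≡0 {suc n} f f≥0 Σf≡0 Fin.zero    | f₀≡0 , _ = f₀≡0
  sum-nonneg-≡0 {suc n} f f≥0 Σf≡0 (Fin.suc i) | _ , Σ≡0 = sum-nonneg-≡0 (f ∘ Fin.suc) (f≥0 ∘ Fin.suc) Σ≡0 i

  sum-neg : ∀ {n} (f : Fin n → ℤ) → sum (λ i → - f i) ≡ - sum f
  sum-neg f = begin
    sum (λ i → - f i)        ≡⟨ sum-cong-≗ (λ i → sym (ℤₚ.-1*i≡-i (f i))) ⟩
    sum (λ i → - 1ℤ * f i)   ≡⟨ *-distribˡ-sum (- 1ℤ) f ⟨
    - 1ℤ * sum f             ≡⟨ ℤₚ.-1*i≡-i (sum f) ⟩
    - sum f                  ∎
    where open ≡-Reasoning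

  ∑-distrib-- : ∀ {n} (f g : Fin n → ℤ) → sum (λ i → f i - g i) ≡ sum f - sum g
  ∑-distrib-- f g = trans (∑-distrib-+ f (λ i → - g i)) (cong (ℤ._+_ (sum f)) (sum-neg g))

  ⌊suc≟suc⌋ : ∀ {n} (i j : Fin n) → ⌊ Fin.suc i ≟ Fin.suc j ⌋ ≡ ⌊ i ≟ j ⌋
  ⌊suc≟suc⌋ i j with i ≟ j
  ... | yes _ = refl
  ... | no _  = refl

  sum-δ : ∀ {n} (f : Fin n → ℤ) (j : Fin n) → sum (λ i → if ⌊ i ≟ j ⌋ then f i else 0ℤ) ≡ f j
  sum-δ {suc n} f Fin.zero = begin
    f Fin.zero + sum {n} (λ _ → 0ℤ)  ≡⟨ cong (ℤ._+_ (f Fin.zero)) (sum-replicate-zero n) ⟩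
    f Fin.zero + 0ℤ                  ≡⟨ ℤₚ.+-identityʳ _ ⟩
    f Fin.zero                       ∎
    where open ≡-Reasoning
  sum-δ {suc n} f (Fin.suc j) = begin
    0ℤ + sum (λ i → if ⌊ Fin.suc i ≟ Fin.suc j ⌋ then f (Fin.suc i) else 0ℤ)
      ≡⟨ ℤₚ.+-identityˡ _ ⟩
    sum (λ i → if ⌊ Fin.suc i ≟ Fin.suc j ⌋ then f (Fin.suc i) else 0ℤ)
      ≡⟨ sum-cong-≗ (λ i → cong (if_then f (Fin.suc i) else 0ℤ) (⌊suc≟suc⌋ i j)) ⟩
    sum (λ i → if ⌊ i ≟ j ⌋ then f (Fin.suc i) else 0ℤ)
      ≡⟨ sum-δ (f ∘ Fin.suc) j ⟩
    f (Fin.suc j) ∎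
    where open ≡-Reasoning

  nonneg⇒0≤x[x-1] : ∀ {x} → 0ℤ ≤ x → 0ℤ ≤ x * (x - 1ℤ)
  nonneg⇒0≤x[x-1] (ℤ.+≤+ {n = zero}  _) = ℤ.+≤+ ℕ.z≤n
  nonneg⇒0≤x[x-1] (ℤ.+≤+ {n = suc m} _) = subst (0ℤ ≤_) (ℤₚ.pos-* (suc m) m) (ℤ.+≤+ ℕ.z≤n)

  x[x-1]≡0⇒x≡0⊎x≡1 : ∀ x → x * (x - 1ℤ) ≡ 0ℤ → x ≡ 0ℤ ⊎ x ≡ 1ℤ
  x[x-1]≡0⇒x≡0⊎x≡1 x eq with ℤₚ.i*j≡0⇒i≡0∨j≡0 x eq
  ... | inj₁ x≡0   = inj₁ x≡0
  ... | inj₂ x-1≡0 = inj₂ (ℤₚ.i-j≡0⇒i≡j x 1ℤ x-1≡0)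

  -- Each term x² − x = x (x − 1) is ≥ 0 for a nonnegative integer x, and these terms sum to 0.
  sum-sq≡sum⇒01 : ∀ {n} (f : Fin n → ℤ) → (∀ i → 0ℤ ≤ f i) →
                  sum (λ i → f i * f i) ≡ sum f → ∀ i → f i ≡ 0ℤ ⊎ f i ≡ 1ℤ
  sum-sq≡sum⇒01 f f≥0 Σf²≡Σf i = x[x-1]≡0⇒x≡0⊎x≡1 (f i)
    (sum-nonneg-≡0 (λ i → f i * (f i - 1ℤ)) (λ i → nonneg⇒0≤x[x-1] (f≥0 i)) Σx[x-1]≡0 i)
    where
    x[x-1]≡x²-x : ∀ x → x * (x - 1ℤ) ≡ x * x - x
    x[x-1]≡x²-x = solve-∀
    Σx[x-1]≡0 : sum (λ i → f i * (f i - 1ℤ)) ≡ 0ℤ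
    Σx[x-1]≡0 = begin
      sum (λ i → f i * (f i - 1ℤ))      ≡⟨ sum-cong-≗ (λ i → x[x-1]≡x²-x (f i)) ⟩
      sum (λ i → f i * f i - f i)       ≡⟨ ∑-distrib-- (λ i → f i * f i) f ⟩
      sum (λ i → f i * f i) - sum f     ≡⟨ cong (_- sum f) Σf²≡Σf ⟩
      sum f - sum f                     ≡⟨ ℤₚ.+-inverseʳ (sum f) ⟩
      0ℤ                                ∎
      where open ≡-Reasoning

  pos-*³ : ∀ a b c → + (a ℕ.* b ℕ.* c) ≡ + a * + b * + c
  pos-*³ a b c = trans (ℤₚ.pos-* (a ℕ.* b) c) (cong (_* + c) (ℤₚ.pos-* a b))

  𝟙 : Bool → ℤ
  𝟙 b = if b then 1ℤ else 0ℤ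

  𝟙-nonneg : ∀ b → 0ℤ ≤ 𝟙 b
  𝟙-nonneg true  = ℤ.+≤+ ℕ.z≤n
  𝟙-nonneg false = ℤ.+≤+ ℕ.z≤n

  𝟙-∧ : ∀ x y → 𝟙 (x ∧ y) ≡ 𝟙 x * 𝟙 y
  𝟙-∧ true  true  = refl
  𝟙-∧ true  false = refl
  𝟙-∧ false y     = sym (ℤₚ.*-zeroˡ (𝟙 y))

  ∣p∣≡sum : ∀ {n} (p : Subset n) → + ∣ p ∣ ≡ sum (𝟙 ∘ lookup p)
  ∣p∣≡sum []          = refl
  ∣p∣≡sum (true ∷ p)  = cong (ℤ._+_ 1ℤ) (∣p∣≡sum p)
  ∣p∣≡sum (false ∷ p) = trans (∣p∣≡sum p) (sym (ℤₚ.+-identityˡ _))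

  𝟙-or≡sum : ∀ {n} (p : Fin n → Bool) → sum (𝟙 ∘ p) ≡ 0ℤ ⊎ sum (𝟙 ∘ p) ≡ 1ℤ →
             𝟙 (or (List.tabulate p)) ≡ sum (𝟙 ∘ p)
  𝟙-or≡sum {zero}  p _ = refl
  𝟙-or≡sum {suc n} p Σ∈01 with p Fin.zero
  ... | true with Σ∈01
  ...   | inj₂ Σ≡1 = sym Σ≡1
  ...   | inj₁ Σ≡0 with subst (1ℤ ≤_) Σ≡0 (ℤₚ.+-monoʳ-≤ 1ℤ (sum-nonneg (𝟙 ∘ p ∘ Fin.suc) (𝟙-nonneg ∘ p ∘ Fin.suc)))
  ...     | ℤ.+≤+ ()
  𝟙-or≡sum {suc n} p Σ∈01 | false = begin
    𝟙 (or (List.tabulate (p ∘ Fin.suc)))  ≡⟨ 𝟙-or≡sum (p ∘ Fin.suc) (Sum.map (trans Σ≡0+Σ) (trans Σ≡0+Σ) Σ∈01) ⟩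
    sum (𝟙 ∘ p ∘ Fin.suc)                 ≡⟨ Σ≡0+Σ ⟩
    0ℤ + sum (𝟙 ∘ p ∘ Fin.suc)            ∎
    where
    open ≡-Reasoning
    Σ≡0+Σ : sum (𝟙 ∘ p ∘ Fin.suc) ≡ 0ℤ + sum (𝟙 ∘ p ∘ Fin.suc)
    Σ≡0+Σ = sym (ℤₚ.+-identityˡ _)

  foldr-+-tabulate : ∀ {n} (f : Fin n → ℤ) → List.foldr _+_ 0ℤ (List.tabulate f) ≡ sum f
  foldr-+-tabulate {zero}  f = refl
  foldr-+-tabulate {suc n} f = cong (ℤ._+_ (f Fin.zero)) (foldr-+-tabulate (f ∘ Fin.suc))

module GroupRing (𝔾 : FinGroup) where
  open ℤ using (ℤ; +_; +0; +[1+_]; -[1+_]; 0ℤ; 1ℤ; _+_; _*_; _-_; _≤_)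
  open IntegerSums
  open FinGroup 𝔾
  open IsGroup isGroup using (assoc; identityˡ; identityʳ; inverseˡ; inverseʳ)

  group : Group 0ℓ 0ℓ
  group = record { isGroup = isGroup }

  open GroupProperties group
    using (⁻¹-involutive; ⁻¹-anti-homo-∙; \\-leftDividesˡ; \\-leftDividesʳ; //-rightDividesʳ)

  infixl 7 _⊛_ _·_
  infixl 6 _⊕_ _⊖_
  infix  4 _≋_
  infix  8 _⁽⁻¹⁾

  ℤ[G] : Set
  ℤ[G] = ZG 𝔾

  _⊛_ _⊕_ _⊖_ : ℤ[G] → ℤ[G] → ℤ[G]
  _⊛_ = _*ᴳ_ 𝔾
  _⊕_ = _+ᴳ_ 𝔾
  _⊖_ = _-ᴳ_ 𝔾

  _·_ : ℕ → ℤ[G] → ℤ[G]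
  _·_ = _·ᴳ_ 𝔾

  𝐞 : ℤ[G]
  𝐞 = eᴳ 𝔾

  ⟪_⟫ : Sub 𝔾 → ℤ[G]
  ⟪_⟫ = ⟦_⟧ 𝔾

  _⁽⁻¹⁾ : ℤ[G] → ℤ[G]
  (a ⁽⁻¹⁾) g = a (g ⁻¹)

  ∑ : ℤ[G] → ℤ
  ∑ = sum {order}

  _≋_ : ℤ[G] → ℤ[G] → Set
  _≋_ = _≈ᴳ_ 𝔾

  ≋-setoid : Setoid 0ℓ 0ℓ
  ≋-setoid = Elt 𝔾 →-setoid ℤ

  open Setoid ≋-setoid public using () renaming (refl to ≋-refl; sym to ≋-sym; trans to ≋-trans)
  module ≋-Reasoning = SetoidReasoning ≋-setoid

  sum-∙ˡ : ∀ x (f : ℤ[G]) → ∑ f ≡ ∑ (λ h → f (x ∙ h))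
  sum-∙ˡ x f = sum-permute f (permutation (x ∙_) ((x ⁻¹) ∙_) (\\-leftDividesˡ x) (\\-leftDividesʳ x))

  sum-⁻¹ : ∀ (f : ℤ[G]) → ∑ f ≡ ∑ (f ⁽⁻¹⁾)
  sum-⁻¹ f = sum-permute f (permutation _⁻¹ _⁻¹ ⁻¹-involutive ⁻¹-involutive)

  ⊛-apply : ∀ a b g → (a ⊛ b) g ≡ ∑ (λ h → a h * b ((h ⁻¹) ∙ g))
  ⊛-apply a b g = trans (cong (List.foldr _+_ 0ℤ) (Listₚ.map-tabulate {n = order} (λ x → x) _)) (foldr-+-tabulate {order} _)

  ⊛-cong : ∀ {a a′ b b′} → a ≋ a′ → b ≋ b′ → a ⊛ b ≋ a′ ⊛ b′
  ⊛-cong {a} {a′} {b} {b′} a≋a′ b≋b′ g = begin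
    (a ⊛ b) g                             ≡⟨ ⊛-apply a b g ⟩
    ∑ (λ h → a h * b ((h ⁻¹) ∙ g))        ≡⟨ sum-cong-≗ (λ h → cong₂ _*_ (a≋a′ h) (b≋b′ ((h ⁻¹) ∙ g))) ⟩
    ∑ (λ h → a′ h * b′ ((h ⁻¹) ∙ g))      ≡⟨ ⊛-apply a′ b′ g ⟨
    (a′ ⊛ b′) g                           ∎
    where open ≡-Reasoning

  ⊛-congˡ : ∀ {a a′} b → a ≋ a′ → a ⊛ b ≋ a′ ⊛ b
  ⊛-congˡ b a≋a′ = ⊛-cong a≋a′ (≋-refl {b})

  ⊛-congʳ : ∀ a {b b′} → b ≋ b′ → a ⊛ b ≋ a ⊛ b′
  ⊛-congʳ a = ⊛-cong (≋-refl {a})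

  ⊛-assoc : ∀ a b c → (a ⊛ b) ⊛ c ≋ a ⊛ (b ⊛ c)
  ⊛-assoc a b c g = begin
    ((a ⊛ b) ⊛ c) g
      ≡⟨ ⊛-apply (a ⊛ b) c g ⟩
    ∑ (λ h → (a ⊛ b) h * c ((h ⁻¹) ∙ g))
      ≡⟨ sum-cong-≗ (λ h → trans (cong (_* c ((h ⁻¹) ∙ g)) (⊛-apply a b h)) (*-distribʳ-sum (c ((h ⁻¹) ∙ g)) (λ k → a k * b ((k ⁻¹) ∙ h)))) ⟩
    ∑ (λ h → ∑ (λ k → a k * b ((k ⁻¹) ∙ h) * c ((h ⁻¹) ∙ g)))
      ≡⟨ ∑-comm (λ h k → a k * b ((k ⁻¹) ∙ h) * c ((h ⁻¹) ∙ g)) ⟩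
    ∑ (λ k → ∑ (λ h → a k * b ((k ⁻¹) ∙ h) * c ((h ⁻¹) ∙ g)))
      ≡⟨ sum-cong-≗ inner ⟩
    ∑ (λ k → a k * (b ⊛ c) ((k ⁻¹) ∙ g))
      ≡⟨ ⊛-apply a (b ⊛ c) g ⟨
    (a ⊛ (b ⊛ c)) g ∎
    where
    open ≡-Reasoning
    inner : ∀ k → ∑ (λ h → a k * b ((k ⁻¹) ∙ h) * c ((h ⁻¹) ∙ g)) ≡ a k * (b ⊛ c) ((k ⁻¹) ∙ g)
    inner k = begin
      ∑ (λ h → a k * b ((k ⁻¹) ∙ h) * c ((h ⁻¹) ∙ g))
        ≡⟨ sum-∙ˡ k _ ⟩
      ∑ (λ h → a k * b ((k ⁻¹) ∙ (k ∙ h)) * c (((k ∙ h) ⁻¹) ∙ g))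
        ≡⟨ sum-cong-≗ (λ h → trans (ℤₚ.*-assoc (a k) _ _)
             (cong₂ (λ u v → a k * (b u * c v)) (\\-leftDividesʳ k h)
               (trans (cong (_∙ g) (⁻¹-anti-homo-∙ k h)) (assoc _ _ _)))) ⟩
      ∑ (λ h → a k * (b h * c ((h ⁻¹) ∙ ((k ⁻¹) ∙ g))))
        ≡⟨ *-distribˡ-sum (a k) (λ h → b h * c ((h ⁻¹) ∙ ((k ⁻¹) ∙ g))) ⟨
      a k * ∑ (λ h → b h * c ((h ⁻¹) ∙ ((k ⁻¹) ∙ g)))
        ≡⟨ cong (a k *_) (⊛-apply b c _) ⟨
      a k * (b ⊛ c) ((k ⁻¹) ∙ g) ∎

  ⊛-distribʳ-⊕ : ∀ a b c → (a ⊕ b) ⊛ c ≋ a ⊛ c ⊕ b ⊛ c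
  ⊛-distribʳ-⊕ a b c g = begin
    ((a ⊕ b) ⊛ c) g                                            ≡⟨ ⊛-apply (a ⊕ b) c g ⟩
    ∑ (λ h → (a h + b h) * c ((h ⁻¹) ∙ g))                   ≡⟨ sum-cong-≗ (λ h → ℤₚ.*-distribʳ-+ (c ((h ⁻¹) ∙ g)) (a h) (b h)) ⟩
    ∑ (λ h → a h * c ((h ⁻¹) ∙ g) + b h * c ((h ⁻¹) ∙ g))    ≡⟨ ∑-distrib-+ (λ h → a h * c ((h ⁻¹) ∙ g)) (λ h → b h * c ((h ⁻¹) ∙ g)) ⟩
    ∑ (λ h → a h * c ((h ⁻¹) ∙ g)) + ∑ (λ h → b h * c ((h ⁻¹) ∙ g))
                                                               ≡⟨ cong₂ _+_ (⊛-apply a c g) (⊛-apply b c g) ⟨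
    (a ⊛ c ⊕ b ⊛ c) g                                          ∎
    where open ≡-Reasoning

  ⊛-distribˡ-⊕ : ∀ a b c → a ⊛ (b ⊕ c) ≋ a ⊛ b ⊕ a ⊛ c
  ⊛-distribˡ-⊕ a b c g = begin
    (a ⊛ (b ⊕ c)) g                                            ≡⟨ ⊛-apply a (b ⊕ c) g ⟩
    ∑ (λ h → a h * (b ((h ⁻¹) ∙ g) + c ((h ⁻¹) ∙ g)))          ≡⟨ sum-cong-≗ (λ h → ℤₚ.*-distribˡ-+ (a h) _ _) ⟩
    ∑ (λ h → a h * b ((h ⁻¹) ∙ g) + a h * c ((h ⁻¹) ∙ g))      ≡⟨ ∑-distrib-+ (λ h → a h * b ((h ⁻¹) ∙ g)) (λ h → a h * c ((h ⁻¹) ∙ g)) ⟩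
    ∑ (λ h → a h * b ((h ⁻¹) ∙ g)) + ∑ (λ h → a h * c ((h ⁻¹) ∙ g))
                                                               ≡⟨ cong₂ _+_ (⊛-apply a b g) (⊛-apply a c g) ⟨
    (a ⊛ b ⊕ a ⊛ c) g                                          ∎
    where open ≡-Reasoning

  ⊛-distribʳ-⊖ : ∀ a b c → (a ⊖ b) ⊛ c ≋ a ⊛ c ⊖ b ⊛ c
  ⊛-distribʳ-⊖ a b c g = begin
    ((a ⊖ b) ⊛ c) g                                            ≡⟨ ⊛-apply (a ⊖ b) c g ⟩
    ∑ (λ h → (a h - b h) * c ((h ⁻¹) ∙ g))                     ≡⟨ sum-cong-≗ (λ h → [x-y]z≡xz-yz (a h) (b h) _) ⟩
    ∑ (λ h → a h * c ((h ⁻¹) ∙ g) - b h * c ((h ⁻¹) ∙ g))      ≡⟨ ∑-distrib-- (λ h → a h * c ((h ⁻¹) ∙ g)) (λ h → b h * c ((h ⁻¹) ∙ g)) ⟩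
    ∑ (λ h → a h * c ((h ⁻¹) ∙ g)) - ∑ (λ h → b h * c ((h ⁻¹) ∙ g))
                                                               ≡⟨ cong₂ _-_ (⊛-apply a c g) (⊛-apply b c g) ⟨
    (a ⊛ c ⊖ b ⊛ c) g                                          ∎
    where
    open ≡-Reasoning
    [x-y]z≡xz-yz : ∀ x y z → (x - y) * z ≡ x * z - y * z
    [x-y]z≡xz-yz = solve-∀

  ⊛-distribˡ-⊖ : ∀ a b c → a ⊛ (b ⊖ c) ≋ a ⊛ b ⊖ a ⊛ c
  ⊛-distribˡ-⊖ a b c g = begin
    (a ⊛ (b ⊖ c)) g                                            ≡⟨ ⊛-apply a (b ⊖ c) g ⟩
    ∑ (λ h → a h * (b ((h ⁻¹) ∙ g) - c ((h ⁻¹) ∙ g)))          ≡⟨ sum-cong-≗ (λ h → x[y-z]≡xy-xz (a h) _ _) ⟩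
    ∑ (λ h → a h * b ((h ⁻¹) ∙ g) - a h * c ((h ⁻¹) ∙ g))      ≡⟨ ∑-distrib-- (λ h → a h * b ((h ⁻¹) ∙ g)) (λ h → a h * c ((h ⁻¹) ∙ g)) ⟩
    ∑ (λ h → a h * b ((h ⁻¹) ∙ g)) - ∑ (λ h → a h * c ((h ⁻¹) ∙ g))
                                                               ≡⟨ cong₂ _-_ (⊛-apply a b g) (⊛-apply a c g) ⟨
    (a ⊛ b ⊖ a ⊛ c) g                                          ∎
    where
    open ≡-Reasoning
    x[y-z]≡xy-xz : ∀ x y z → x * (y - z) ≡ x * y - x * z
    x[y-z]≡xy-xz = solve-∀

  ·-⊛-assoc : ∀ k a b → (k · a) ⊛ b ≋ k · (a ⊛ b)
  ·-⊛-assoc k a b g = begin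
    ((k · a) ⊛ b) g                        ≡⟨ ⊛-apply (k · a) b g ⟩
    ∑ (λ h → + k * a h * b ((h ⁻¹) ∙ g))   ≡⟨ sum-cong-≗ (λ h → ℤₚ.*-assoc (+ k) (a h) _) ⟩
    ∑ (λ h → + k * (a h * b ((h ⁻¹) ∙ g))) ≡⟨ *-distribˡ-sum (+ k) (λ h → a h * b ((h ⁻¹) ∙ g)) ⟨
    + k * ∑ (λ h → a h * b ((h ⁻¹) ∙ g))   ≡⟨ cong (+ k *_) (⊛-apply a b g) ⟨
    (k · (a ⊛ b)) g                        ∎
    where open ≡-Reasoning

  ⊛-·-comm : ∀ k a b → a ⊛ (k · b) ≋ k · (a ⊛ b)
  ⊛-·-comm k a b g = begin
    (a ⊛ (k · b)) g                        ≡⟨ ⊛-apply a (k · b) g ⟩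
    ∑ (λ h → a h * (+ k * b ((h ⁻¹) ∙ g))) ≡⟨ sum-cong-≗ (λ h → x[ky]≡k[xy] (a h) (+ k) _) ⟩
    ∑ (λ h → + k * (a h * b ((h ⁻¹) ∙ g))) ≡⟨ *-distribˡ-sum (+ k) (λ h → a h * b ((h ⁻¹) ∙ g)) ⟨
    + k * ∑ (λ h → a h * b ((h ⁻¹) ∙ g))   ≡⟨ cong (+ k *_) (⊛-apply a b g) ⟨
    (k · (a ⊛ b)) g                        ∎
    where
    open ≡-Reasoning
    x[ky]≡k[xy] : ∀ x k y → x * (k * y) ≡ k * (x * y)
    x[ky]≡k[xy] = solve-∀

  𝐞-ε : 𝐞 ε ≡ 1ℤ
  𝐞-ε with ε ≟ ε
  ... | yes _   = refl
  ... | no ε≢ε = ⊥-elim (ε≢ε refl)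

  𝐞-≢ε : ∀ {x} → x ≢ ε → 𝐞 x ≡ 0ℤ
  𝐞-≢ε {x} x≢ε with x ≟ ε
  ... | yes x≡ε = ⊥-elim (x≢ε x≡ε)
  ... | no _    = refl

  ⊛-identityʳ : ∀ a → a ⊛ 𝐞 ≋ a
  ⊛-identityʳ a g = trans (⊛-apply a 𝐞 g) (trans (sum-cong-≗ δ-term) (sum-δ a g))
    where
    δ-term : ∀ h → a h * 𝐞 ((h ⁻¹) ∙ g) ≡ (if ⌊ h ≟ g ⌋ then a h else 0ℤ)
    δ-term h with h ≟ g
    ... | yes refl = trans (cong (λ x → a h * 𝐞 x) (inverseˡ h)) (trans (cong (a h *_) 𝐞-ε) (ℤₚ.*-identityʳ (a h)))
    ... | no h≢g   = trans (cong (a h *_) (𝐞-≢ε h⁻¹g≢ε)) (ℤₚ.*-zeroʳ (a h))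
      where
      h⁻¹g≢ε : (h ⁻¹) ∙ g ≢ ε
      h⁻¹g≢ε h⁻¹g≡ε = h≢g (sym (trans (sym (\\-leftDividesˡ h g)) (trans (cong (h ∙_) h⁻¹g≡ε) (identityʳ h))))

  [gh]⁻¹g≡h⁻¹ : ∀ g h → ((g ∙ h) ⁻¹) ∙ g ≡ h ⁻¹
  [gh]⁻¹g≡h⁻¹ g h = begin
    ((g ∙ h) ⁻¹) ∙ g           ≡⟨ cong (_∙ g) (⁻¹-anti-homo-∙ g h) ⟩
    ((h ⁻¹) ∙ (g ⁻¹)) ∙ g      ≡⟨ assoc _ _ _ ⟩
    (h ⁻¹) ∙ ((g ⁻¹) ∙ g)      ≡⟨ cong ((h ⁻¹) ∙_) (inverseˡ g) ⟩
    (h ⁻¹) ∙ ε                 ≡⟨ identityʳ (h ⁻¹) ⟩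
    h ⁻¹                       ∎
    where open ≡-Reasoning

  ⁽⁻¹⁾-⊛ : ∀ a b → (a ⊛ b) ⁽⁻¹⁾ ≋ b ⁽⁻¹⁾ ⊛ a ⁽⁻¹⁾
  ⁽⁻¹⁾-⊛ a b g = begin
    (a ⊛ b) (g ⁻¹)                                        ≡⟨ ⊛-apply a b (g ⁻¹) ⟩
    ∑ (λ h → a h * b ((h ⁻¹) ∙ (g ⁻¹)))                   ≡⟨ sum-cong-≗ (λ h → ℤₚ.*-comm (a h) _) ⟩
    ∑ (λ h → b ((h ⁻¹) ∙ (g ⁻¹)) * a h)
      ≡⟨ sum-cong-≗ (λ h → cong₂ (λ u v → b u * a v) (sym (⁻¹-anti-homo-∙ g h))
                             (sym (trans (cong _⁻¹ ([gh]⁻¹g≡h⁻¹ g h)) (⁻¹-involutive h)))) ⟩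
    ∑ (λ h → b ((g ∙ h) ⁻¹) * a ((((g ∙ h) ⁻¹) ∙ g) ⁻¹))  ≡⟨ sum-∙ˡ g (λ h → b (h ⁻¹) * a (((h ⁻¹) ∙ g) ⁻¹)) ⟨
    ∑ (λ h → b (h ⁻¹) * a (((h ⁻¹) ∙ g) ⁻¹))              ≡⟨ ⊛-apply (b ⁽⁻¹⁾) (a ⁽⁻¹⁾) g ⟨
    (b ⁽⁻¹⁾ ⊛ a ⁽⁻¹⁾) g                                   ∎
    where open ≡-Reasoning

  ∑-⊛ : ∀ a b → ∑ (a ⊛ b) ≡ ∑ a * ∑ b
  ∑-⊛ a b = begin
    ∑ (a ⊛ b)                                  ≡⟨ sum-cong-≗ (⊛-apply a b) ⟩
    ∑ (λ g → ∑ (λ h → a h * b ((h ⁻¹) ∙ g)))  ≡⟨ ∑-comm (λ g h → a h * b ((h ⁻¹) ∙ g)) ⟩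
    ∑ (λ h → ∑ (λ g → a h * b ((h ⁻¹) ∙ g)))  ≡⟨ sum-cong-≗ (λ h → *-distribˡ-sum (a h) (λ g → b ((h ⁻¹) ∙ g))) ⟨
    ∑ (λ h → a h * ∑ (λ g → b ((h ⁻¹) ∙ g)))  ≡⟨ sum-cong-≗ (λ h → cong (a h *_) (sum-∙ˡ (h ⁻¹) b)) ⟨
    ∑ (λ h → a h * ∑ b)                        ≡⟨ *-distribʳ-sum (∑ b) a ⟨
    ∑ a * ∑ b                                  ∎
    where open ≡-Reasoning

  ⊛⁽⁻¹⁾-at-ε : ∀ a → (a ⊛ a ⁽⁻¹⁾) ε ≡ ∑ (λ g → a g * a g)
  ⊛⁽⁻¹⁾-at-ε a = trans (⊛-apply a (a ⁽⁻¹⁾) ε)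
    (sum-cong-≗ (λ h → cong (λ x → a h * a x) (trans (cong _⁻¹ (identityʳ (h ⁻¹))) (⁻¹-involutive h))))

  ⊛⁽⁻¹⁾-at-ε≡0⇒≋0 : ∀ a → (a ⊛ a ⁽⁻¹⁾) ε ≡ 0ℤ → ∀ g → a g ≡ 0ℤ
  ⊛⁽⁻¹⁾-at-ε≡0⇒≋0 a aa⁽⁻¹⁾≡0 g = x*x≡0⇒x≡0 (a g)
    (sum-nonneg-≡0 (λ g → a g * a g) (λ g → x*x-nonneg (a g)) (trans (sym (⊛⁽⁻¹⁾-at-ε a)) aa⁽⁻¹⁾≡0) g)
    where
    x*x-nonneg : ∀ x → 0ℤ ≤ x * x
    x*x-nonneg +0       = ℤ.+≤+ ℕ.z≤n
    x*x-nonneg +[1+ _ ] = ℤ.+≤+ ℕ.z≤n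
    x*x-nonneg -[1+ _ ] = ℤ.+≤+ ℕ.z≤n
    x*x≡0⇒x≡0 : ∀ x → x * x ≡ 0ℤ → x ≡ 0ℤ
    x*x≡0⇒x≡0 x x²≡0 = Sum.reduce (ℤₚ.i*j≡0⇒i≡0∨j≡0 x x²≡0)

  ⊕-cong : ∀ {a a′ b b′} → a ≋ a′ → b ≋ b′ → a ⊕ b ≋ a′ ⊕ b′
  ⊕-cong a≋a′ b≋b′ g = cong₂ _+_ (a≋a′ g) (b≋b′ g)

  ⊖-cong : ∀ {a a′ b b′} → a ≋ a′ → b ≋ b′ → a ⊖ b ≋ a′ ⊖ b′
  ⊖-cong a≋a′ b≋b′ g = cong₂ _-_ (a≋a′ g) (b≋b′ g)

  ·-cong : ∀ k {a a′} → a ≋ a′ → k · a ≋ k · a′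
  ·-cong k a≋a′ g = cong (+ k *_) (a≋a′ g)

  ·-cancelˡ : ∀ k {a b} .{{_ : ℕ.NonZero k}} → k · a ≋ k · b → a ≋ b
  ·-cancelˡ k {a} {b} ka≋kb g = ℤₚ.*-cancelˡ-≡ (+ k) (a g) (b g) (ka≋kb g)

  ⊛-sandwich : ∀ a d k l b c → a ⊛ (k · 𝐞 ⊕ l · (b ⊖ c)) ⊛ d ≋ k · (a ⊛ d) ⊕ l · (a ⊛ b ⊛ d ⊖ a ⊛ c ⊛ d)
  ⊛-sandwich a d k l b c = begin
    a ⊛ (k · 𝐞 ⊕ l · (b ⊖ c)) ⊛ d          ≈⟨ ⊛-congˡ d (⊛-distribˡ-⊕ a (k · 𝐞) (l · (b ⊖ c))) ⟩
    (a ⊛ (k · 𝐞) ⊕ a ⊛ (l · (b ⊖ c))) ⊛ d  ≈⟨ ⊛-congˡ d (⊕-cong ae≋a abc≋ab-ac) ⟩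
    (k · a ⊕ l · (a ⊛ b ⊖ a ⊛ c)) ⊛ d      ≈⟨ ⊛-distribʳ-⊕ (k · a) (l · (a ⊛ b ⊖ a ⊛ c)) d ⟩
    k · a ⊛ d ⊕ l · (a ⊛ b ⊖ a ⊛ c) ⊛ d    ≈⟨ ⊕-cong (·-⊛-assoc k a d) (·-⊛-assoc l (a ⊛ b ⊖ a ⊛ c) d) ⟩
    k · (a ⊛ d) ⊕ l · ((a ⊛ b ⊖ a ⊛ c) ⊛ d) ≈⟨ ⊕-cong (≋-refl {k · (a ⊛ d)}) (·-cong l (⊛-distribʳ-⊖ (a ⊛ b) (a ⊛ c) d)) ⟩
    k · (a ⊛ d) ⊕ l · (a ⊛ b ⊛ d ⊖ a ⊛ c ⊛ d) ∎
    where
    open ≋-Reasoning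
    ae≋a : a ⊛ (k · 𝐞) ≋ k · a
    ae≋a = ≋-trans (⊛-·-comm k a 𝐞) (·-cong k (⊛-identityʳ a))
    abc≋ab-ac : a ⊛ (l · (b ⊖ c)) ≋ l · (a ⊛ b ⊖ a ⊛ c)
    abc≋ab-ac = ≋-trans (⊛-·-comm l a (b ⊖ c)) (·-cong l (⊛-distribˡ-⊖ a b c))

  ∑⟪⟫ : ∀ A → ∑ ⟪ A ⟫ ≡ + ∣ A ∣
  ∑⟪⟫ A = sym (∣p∣≡sum A)

  ⟪inv⟫ : ∀ A → ⟪ inv 𝔾 A ⟫ ≋ ⟪ A ⟫ ⁽⁻¹⁾
  ⟪inv⟫ A g = cong 𝟙 (Vecₚ.lookup∘tabulate (λ x → lookup A (x ⁻¹)) g)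

  ⟪inv∘inv⟫ : ∀ A → ⟪ inv 𝔾 (inv 𝔾 A) ⟫ ≋ ⟪ A ⟫
  ⟪inv∘inv⟫ A g = trans (⟪inv⟫ (inv 𝔾 A) g) (trans (⟪inv⟫ A (g ⁻¹)) (cong ⟪ A ⟫ (⁻¹-involutive g)))

  ∣inv∣ : ∀ A → ∣ inv 𝔾 A ∣ ≡ ∣ A ∣
  ∣inv∣ A = ℤₚ.+-injective (begin
    + ∣ inv 𝔾 A ∣     ≡⟨ ∑⟪⟫ (inv 𝔾 A) ⟨
    ∑ ⟪ inv 𝔾 A ⟫     ≡⟨ sum-cong-≗ (⟪inv⟫ A) ⟩
    ∑ (⟪ A ⟫ ⁽⁻¹⁾)    ≡⟨ sum-⁻¹ ⟪ A ⟫ ⟨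
    ∑ ⟪ A ⟫           ≡⟨ ∑⟪⟫ A ⟩
    + ∣ A ∣           ∎)
    where open ≡-Reasoning

  ⟪∩⟫ : ∀ A B g → ⟪ A ∩ B ⟫ g ≡ ⟪ A ⟫ g * ⟪ B ⟫ g
  ⟪∩⟫ A B g = trans (cong 𝟙 (Vecₚ.lookup-zipWith _∧_ g A B)) (𝟙-∧ (lookup A g) (lookup B g))

  ⟪⊤⟫ : ∀ g → ⟪ ⊤ ⟫ g ≡ 1ℤ
  ⟪⊤⟫ g = cong 𝟙 (Vecₚ.lookup-replicate g true)

  ⟪⟫⊛⟪⟫-nonneg : ∀ A B g → 0ℤ ≤ (⟪ A ⟫ ⊛ ⟪ B ⟫) g
  ⟪⟫⊛⟪⟫-nonneg A B g = subst (0ℤ ≤_) (sym (⊛-apply ⟪ A ⟫ ⟪ B ⟫ g))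
    (sum-nonneg _ (λ h → subst (0ℤ ≤_) (𝟙-∧ (lookup A h) (lookup B ((h ⁻¹) ∙ g))) (𝟙-nonneg _)))

  ⟪prodSet⟫ : ∀ X Y g → (⟪ X ⟫ ⊛ ⟪ Y ⟫) g ≡ 0ℤ ⊎ (⟪ X ⟫ ⊛ ⟪ Y ⟫) g ≡ 1ℤ →
              ⟪ prodSet 𝔾 X Y ⟫ g ≡ (⟪ X ⟫ ⊛ ⟪ Y ⟫) g
  ⟪prodSet⟫ X Y g XY∈01 = begin
    ⟪ prodSet 𝔾 X Y ⟫ g
      ≡⟨ cong 𝟙 (Vecₚ.lookup∘tabulate (λ g → or (List.map (xy≡ g) (List.allFin order))) g) ⟩
    𝟙 (or (List.map (xy≡ g) (List.allFin order)))
      ≡⟨ cong (𝟙 ∘ or) (Listₚ.map-tabulate (λ x → x) (xy≡ g)) ⟩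
    𝟙 (or (List.tabulate (xy≡ g)))
      ≡⟨ 𝟙-or≡sum (xy≡ g) (Sum.map (trans #xy≡g) (trans #xy≡g) XY∈01) ⟩
    ∑ (𝟙 ∘ xy≡ g)
      ≡⟨ #xy≡g ⟩
    (⟪ X ⟫ ⊛ ⟪ Y ⟫) g ∎
    where
    open ≡-Reasoning
    xy≡ : Elt 𝔾 → Elt 𝔾 → Bool
    xy≡ g x = lookup X x ∧ lookup Y ((x ⁻¹) ∙ g)
    #xy≡g : ∑ (𝟙 ∘ xy≡ g) ≡ (⟪ X ⟫ ⊛ ⟪ Y ⟫) g
    #xy≡g = trans (sum-cong-≗ (λ x → 𝟙-∧ (lookup X x) (lookup Y ((x ⁻¹) ∙ g)))) (sym (⊛-apply ⟪ X ⟫ ⟪ Y ⟫ g))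

  ⊤≤G : IsSubgroup 𝔾 ⊤
  ⊤≤G = record { ε∈ = Subsetₚ.∈⊤ ; ∙-closed = λ _ _ → Subsetₚ.∈⊤ ; ⁻¹-closed = λ _ → Subsetₚ.∈⊤ }

  ∈⇒𝟙≡1 : ∀ {A x} → x ∈ A → ⟪ A ⟫ x ≡ 1ℤ
  ∈⇒𝟙≡1 x∈A = cong 𝟙 (Vecₚ.[]=⇒lookup x∈A)

  module Subgroup {H : Sub 𝔾} (H≤G : IsSubgroup 𝔾 H) where
    open IsSubgroup H≤G

    lookup-∙ˡ : ∀ {a} g → a ∈ H → lookup H (a ∙ g) ≡ lookup H g
    lookup-∙ˡ {a} g a∈H = ∈⇔⇒lookup≡ H (mk⇔
      (λ ag∈H → subst (_∈ H) (\\-leftDividesʳ a g) (∙-closed (⁻¹-closed a∈H) ag∈H))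
      (∙-closed a∈H))

    lookup-∙ʳ : ∀ {b} g → b ∈ H → lookup H (g ∙ b) ≡ lookup H g
    lookup-∙ʳ {b} g b∈H = ∈⇔⇒lookup≡ H (mk⇔
      (λ gb∈H → subst (_∈ H) (//-rightDividesʳ b g) (∙-closed gb∈H (⁻¹-closed b∈H)))
      (λ g∈H → ∙-closed g∈H b∈H))

    lookup-⁻¹ : ∀ g → lookup H (g ⁻¹) ≡ lookup H g
    lookup-⁻¹ g = ∈⇔⇒lookup≡ H (mk⇔ (subst (_∈ H) (⁻¹-involutive g) ∘ ⁻¹-closed) ⁻¹-closed)

    ⟪H⟫⁽⁻¹⁾ : ⟪ H ⟫ ⁽⁻¹⁾ ≋ ⟪ H ⟫
    ⟪H⟫⁽⁻¹⁾ g = cong 𝟙 (lookup-⁻¹ g)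

    inv⊆ : ∀ {X} → X ⊆ H → inv 𝔾 X ⊆ H
    inv⊆ {X} X⊆H {x} x∈X⁻¹ = subst (_∈ H) (⁻¹-involutive x) (⁻¹-closed (X⊆H (Vecₚ.lookup⇒[]= (x ⁻¹) X
      (trans (sym (Vecₚ.lookup∘tabulate (λ y → lookup X (y ⁻¹)) x)) (Vecₚ.[]=⇒lookup x∈X⁻¹)))))

    ⊛-absorbʳ : ∀ {A} → A ⊆ H → ⟪ A ⟫ ⊛ ⟪ H ⟫ ≋ ∣ A ∣ · ⟪ H ⟫
    ⊛-absorbʳ {A} A⊆H g = begin
      (⟪ A ⟫ ⊛ ⟪ H ⟫) g                          ≡⟨ ⊛-apply ⟪ A ⟫ ⟪ H ⟫ g ⟩
      ∑ (λ h → ⟪ A ⟫ h * ⟪ H ⟫ ((h ⁻¹) ∙ g))     ≡⟨ sum-cong-≗ absorb ⟩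
      ∑ (λ h → ⟪ A ⟫ h * ⟪ H ⟫ g)                ≡⟨ *-distribʳ-sum (⟪ H ⟫ g) ⟪ A ⟫ ⟨
      ∑ ⟪ A ⟫ * ⟪ H ⟫ g                          ≡⟨ cong (_* ⟪ H ⟫ g) (∑⟪⟫ A) ⟩
      + ∣ A ∣ * ⟪ H ⟫ g                          ∎
      where
      open ≡-Reasoning
      absorb : ∀ h → ⟪ A ⟫ h * ⟪ H ⟫ ((h ⁻¹) ∙ g) ≡ ⟪ A ⟫ h * ⟪ H ⟫ g
      absorb h with lookup A h in h∈?A
      ... | true  = cong (λ b → 1ℤ * 𝟙 b) (lookup-∙ˡ g (⁻¹-closed (A⊆H (Vecₚ.lookup⇒[]= h A h∈?A))))
      ... | false = refl

    ⊛-absorbˡ : ∀ {A} → A ⊆ H → ⟪ H ⟫ ⊛ ⟪ A ⟫ ≋ ∣ A ∣ · ⟪ H ⟫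
    ⊛-absorbˡ {A} A⊆H g = begin
      (⟪ H ⟫ ⊛ ⟪ A ⟫) g                       ≡⟨ cong (⟪ H ⟫ ⊛ ⟪ A ⟫) (⁻¹-involutive g) ⟨
      (⟪ H ⟫ ⊛ ⟪ A ⟫) ((g ⁻¹) ⁻¹)             ≡⟨ ⁽⁻¹⁾-⊛ ⟪ H ⟫ ⟪ A ⟫ (g ⁻¹) ⟩
      (⟪ A ⟫ ⁽⁻¹⁾ ⊛ ⟪ H ⟫ ⁽⁻¹⁾) (g ⁻¹)        ≡⟨ ⊛-cong (≋-sym (⟪inv⟫ A)) ⟪H⟫⁽⁻¹⁾ (g ⁻¹) ⟩
      (⟪ inv 𝔾 A ⟫ ⊛ ⟪ H ⟫) (g ⁻¹)            ≡⟨ ⊛-absorbʳ (inv⊆ A⊆H) (g ⁻¹) ⟩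
      + ∣ inv 𝔾 A ∣ * ⟪ H ⟫ (g ⁻¹)            ≡⟨ cong₂ (λ k x → + k * x) (∣inv∣ A) (⟪H⟫⁽⁻¹⁾ g) ⟩
      + ∣ A ∣ * ⟪ H ⟫ g                       ∎
      where open ≡-Reasoning

    ⟪H⟫⊛-invariantˡ : ∀ f {a} g → a ∈ H → (⟪ H ⟫ ⊛ f) (a ∙ g) ≡ (⟪ H ⟫ ⊛ f) g
    ⟪H⟫⊛-invariantˡ f {a} g a∈H = begin
      (⟪ H ⟫ ⊛ f) (a ∙ g)                                    ≡⟨ ⊛-apply ⟪ H ⟫ f (a ∙ g) ⟩
      ∑ (λ h → ⟪ H ⟫ h * f ((h ⁻¹) ∙ (a ∙ g)))               ≡⟨ sum-∙ˡ a _ ⟩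
      ∑ (λ h → ⟪ H ⟫ (a ∙ h) * f (((a ∙ h) ⁻¹) ∙ (a ∙ g)))   ≡⟨ sum-cong-≗ shift ⟩
      ∑ (λ h → ⟪ H ⟫ h * f ((h ⁻¹) ∙ g))                     ≡⟨ ⊛-apply ⟪ H ⟫ f g ⟨
      (⟪ H ⟫ ⊛ f) g                                          ∎
      where
      open ≡-Reasoning
      shift : ∀ h → ⟪ H ⟫ (a ∙ h) * f (((a ∙ h) ⁻¹) ∙ (a ∙ g)) ≡ ⟪ H ⟫ h * f ((h ⁻¹) ∙ g)
      shift h = cong₂ (λ u v → 𝟙 u * f v) (lookup-∙ˡ h a∈H)
        (trans (cong (_∙ (a ∙ g)) (⁻¹-anti-homo-∙ a h)) (trans (assoc _ _ _) (cong ((h ⁻¹) ∙_) (\\-leftDividesʳ a g))))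

    ⊛⟪H⟫-invariantʳ : ∀ f {b} g → b ∈ H → (f ⊛ ⟪ H ⟫) (g ∙ b) ≡ (f ⊛ ⟪ H ⟫) g
    ⊛⟪H⟫-invariantʳ f {b} g b∈H = begin
      (f ⊛ ⟪ H ⟫) (g ∙ b)                          ≡⟨ ⊛-apply f ⟪ H ⟫ (g ∙ b) ⟩
      ∑ (λ h → f h * ⟪ H ⟫ ((h ⁻¹) ∙ (g ∙ b)))     ≡⟨ sum-cong-≗ shift ⟩
      ∑ (λ h → f h * ⟪ H ⟫ ((h ⁻¹) ∙ g))           ≡⟨ ⊛-apply f ⟪ H ⟫ g ⟨
      (f ⊛ ⟪ H ⟫) g                                ∎
      where
      open ≡-Reasoning
      shift : ∀ h → f h * ⟪ H ⟫ ((h ⁻¹) ∙ (g ∙ b)) ≡ f h * ⟪ H ⟫ ((h ⁻¹) ∙ g)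
      shift h = cong (λ u → f h * 𝟙 u) (trans (cong (lookup H) (sym (assoc _ _ _))) (lookup-∙ʳ ((h ⁻¹) ∙ g) b∈H))

  ⊛-factorisation : ∀ {H K} → IsSubgroup 𝔾 H → IsSubgroup 𝔾 K →
                    (∀ g → Σ (Elt 𝔾) λ a → Σ (Elt 𝔾) λ b → a ∈ H × b ∈ K × g ≡ a ∙ b) →
                    ⟪ H ⟫ ⊛ ⟪ K ⟫ ≋ ∣ H ∩ K ∣ · ⟪ ⊤ ⟫
  ⊛-factorisation {H} {K} H≤G K≤G G≡HK g with G≡HK g
  ... | a , b , a∈H , b∈K , refl = begin
    (⟪ H ⟫ ⊛ ⟪ K ⟫) (a ∙ b)                       ≡⟨ Subgroup.⟪H⟫⊛-invariantˡ H≤G ⟪ K ⟫ b a∈H ⟩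
    (⟪ H ⟫ ⊛ ⟪ K ⟫) b                             ≡⟨ cong (⟪ H ⟫ ⊛ ⟪ K ⟫) (identityˡ b) ⟨
    (⟪ H ⟫ ⊛ ⟪ K ⟫) (ε ∙ b)                       ≡⟨ Subgroup.⊛⟪H⟫-invariantʳ K≤G ⟪ H ⟫ ε b∈K ⟩
    (⟪ H ⟫ ⊛ ⟪ K ⟫) ε                             ≡⟨ ⊛-apply ⟪ H ⟫ ⟪ K ⟫ ε ⟩
    ∑ (λ h → ⟪ H ⟫ h * ⟪ K ⟫ ((h ⁻¹) ∙ ε))        ≡⟨ sum-cong-≗ in-H∩K ⟩
    ∑ ⟪ H ∩ K ⟫                                   ≡⟨ ∑⟪⟫ (H ∩ K) ⟩
    + ∣ H ∩ K ∣                                   ≡⟨ ℤₚ.*-identityʳ (+ ∣ H ∩ K ∣) ⟨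
    + ∣ H ∩ K ∣ * 1ℤ                              ≡⟨ cong (+ ∣ H ∩ K ∣ *_) (⟪⊤⟫ (a ∙ b)) ⟨
    + ∣ H ∩ K ∣ * ⟪ ⊤ ⟫ (a ∙ b)                   ∎
    where
    open ≡-Reasoning
    in-H∩K : ∀ h → ⟪ H ⟫ h * ⟪ K ⟫ ((h ⁻¹) ∙ ε) ≡ ⟪ H ∩ K ⟫ h
    in-H∩K h = trans (cong (λ x → ⟪ H ⟫ h * ⟪ K ⟫ x) (identityʳ (h ⁻¹)))
      (trans (cong (λ u → ⟪ H ⟫ h * 𝟙 u) (Subgroup.lookup-⁻¹ K≤G h)) (sym (⟪∩⟫ H K h)))

  -- Reindexing by h ↦ g h⁻¹ turns N X at g into a count of the x ∈ X with x g⁻¹ ∈ N.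
  ∣X∩Ng∣≡⟪N⟫⊛⟪X⟫ : ∀ {N} → IsSubgroup 𝔾 N → ∀ X g → + ∣ X ∩ coset 𝔾 N g ∣ ≡ (⟪ N ⟫ ⊛ ⟪ X ⟫) g
  ∣X∩Ng∣≡⟪N⟫⊛⟪X⟫ {N} N≤G X g = begin
    + ∣ X ∩ coset 𝔾 N g ∣                                      ≡⟨ ∑⟪⟫ (X ∩ coset 𝔾 N g) ⟨
    ∑ ⟪ X ∩ coset 𝔾 N g ⟫                                      ≡⟨ sum-cong-≗ term ⟨
    ∑ (λ h → ⟪ N ⟫ (g ∙ (h ⁻¹)) * ⟪ X ⟫ (((g ∙ (h ⁻¹)) ⁻¹) ∙ g))
                                                               ≡⟨ sum-⁻¹ (λ h → ⟪ N ⟫ (g ∙ h) * ⟪ X ⟫ (((g ∙ h) ⁻¹) ∙ g)) ⟨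
    ∑ (λ h → ⟪ N ⟫ (g ∙ h) * ⟪ X ⟫ (((g ∙ h) ⁻¹) ∙ g))         ≡⟨ sum-∙ˡ g (λ h → ⟪ N ⟫ h * ⟪ X ⟫ ((h ⁻¹) ∙ g)) ⟨
    ∑ (λ h → ⟪ N ⟫ h * ⟪ X ⟫ ((h ⁻¹) ∙ g))                     ≡⟨ ⊛-apply ⟪ N ⟫ ⟪ X ⟫ g ⟨
    (⟪ N ⟫ ⊛ ⟪ X ⟫) g                                          ∎
    where
    open ≡-Reasoning
    term : ∀ h → ⟪ N ⟫ (g ∙ (h ⁻¹)) * ⟪ X ⟫ (((g ∙ (h ⁻¹)) ⁻¹) ∙ g) ≡ ⟪ X ∩ coset 𝔾 N g ⟫ h
    term h = begin
      ⟪ N ⟫ (g ∙ (h ⁻¹)) * ⟪ X ⟫ (((g ∙ (h ⁻¹)) ⁻¹) ∙ g)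
        ≡⟨ cong (λ x → ⟪ N ⟫ (g ∙ (h ⁻¹)) * ⟪ X ⟫ x) (trans ([gh]⁻¹g≡h⁻¹ g (h ⁻¹)) (⁻¹-involutive h)) ⟩
      ⟪ N ⟫ (g ∙ (h ⁻¹)) * ⟪ X ⟫ h
        ≡⟨ ℤₚ.*-comm (⟪ N ⟫ (g ∙ (h ⁻¹))) (⟪ X ⟫ h) ⟩
      ⟪ X ⟫ h * ⟪ N ⟫ (g ∙ (h ⁻¹))
        ≡⟨ cong (λ u → ⟪ X ⟫ h * 𝟙 u) in-Ng ⟩
      ⟪ X ⟫ h * ⟪ coset 𝔾 N g ⟫ h
        ≡⟨ ⟪∩⟫ X (coset 𝔾 N g) h ⟨
      ⟪ X ∩ coset 𝔾 N g ⟫ h ∎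
      where
      in-Ng : lookup N (g ∙ (h ⁻¹)) ≡ lookup (coset 𝔾 N g) h
      in-Ng = begin
        lookup N (g ∙ (h ⁻¹))          ≡⟨ Subgroup.lookup-⁻¹ N≤G (g ∙ (h ⁻¹)) ⟨
        lookup N ((g ∙ (h ⁻¹)) ⁻¹)     ≡⟨ cong (lookup N) (trans (⁻¹-anti-homo-∙ g (h ⁻¹)) (cong (_∙ (g ⁻¹)) (⁻¹-involutive h))) ⟩
        lookup N (h ∙ (g ⁻¹))          ≡⟨ Vecₚ.lookup∘tabulate (λ x → lookup N (x ∙ (g ⁻¹))) h ⟨
        lookup (coset 𝔾 N g) h         ∎

  transversal⇒semiregular : ∀ {H N X} → IsSubgroup 𝔾 N → ⟪ N ⟫ ⊛ ⟪ X ⟫ ≋ ⟪ H ⟫ → IsSemiregular 𝔾 H N X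
  transversal⇒semiregular {X = X} N≤G NX≋H g g∈H =
    ℤₚ.+-injective (trans (∣X∩Ng∣≡⟪N⟫⊛⟪X⟫ N≤G X g) (trans (NX≋H g) (∈⇒𝟙≡1 g∈H)))

module RelativeDifferenceSets (𝔾 : FinGroup) where
  open ℤ using (ℤ; +_; -[1+_]; 0ℤ; 1ℤ; -_; _+_; _*_; _-_; _≤_)
  open IntegerSums
  open FinGroup 𝔾
  open GroupRing 𝔾

  ∣H∣>0 : ∀ {H} → IsSubgroup 𝔾 H → 0 ℕ.< ∣ H ∣
  ∣H∣>0 H≤G = ℕₚ.≤-<-trans ℕ.z≤n (Subsetₚ.x∈p⇒∣p-x∣<∣p∣ (IsSubgroup.ε∈ H≤G))

  transversal-identity : ∀ n l (x y : ℤ) →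
    (+ (n ℕ.* l) * (+ n * x) + + l * (+ n * (+ n * y) - + n * (+ n * x)) - + (n ℕ.* l) * (+ n * y))
      - (+ (n ℕ.* l) * (+ n * y) - + (n ℕ.* l ℕ.* n) * y) ≡ 0ℤ
  transversal-identity n l x y = trans (cong₂ E (ℤₚ.pos-* n l) (pos-*³ n l n)) (ring (+ n) (+ l) x y)
    where
    E : ℤ → ℤ → ℤ
    E k m = (k * (+ n * x) + + l * (+ n * (+ n * y) - + n * (+ n * x)) - k * (+ n * y)) - (k * (+ n * y) - m * y)
    ring : ∀ n l x y → (n * l * (n * x) + l * (n * (n * y) - n * (n * x)) - n * l * (n * y))
                         - (n * l * (n * y) - n * l * n * y) ≡ 0ℤ
    ring = solve-∀

  rds⇒transversal : ∀ {H N X n l} → IsRDS 𝔾 H N X (n ℕ.* l) n (n ℕ.* l) l → ⟪ N ⟫ ⊛ ⟪ X ⟫ ≋ ⟪ H ⟫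
  rds⇒transversal {H} {N} {X} {n} {l} rds g = ℤₚ.i-j≡0⇒i≡j _ _ (⊛⁽⁻¹⁾-at-ε≡0⇒≋0 D (DD⁽⁻¹⁾≋0 ε) g)
    where
    open IsRDS rds
    open Subgroup H-subgroup using (⊛-absorbʳ; ⊛-absorbˡ; ⟪H⟫⁽⁻¹⁾; inv⊆)
    k : ℕ
    k = n ℕ.* l
    𝐍 𝐇 𝐗 𝐗′ D : ℤ[G]
    𝐍 = ⟪ N ⟫
    𝐇 = ⟪ H ⟫
    𝐗 = ⟪ X ⟫
    𝐗′ = ⟪ inv 𝔾 X ⟫
    D = 𝐍 ⊛ 𝐗 ⊖ 𝐇

    NN : 𝐍 ⊛ 𝐍 ≋ n · 𝐍
    NN = subst (λ m → 𝐍 ⊛ 𝐍 ≋ m · 𝐍) |N|≡n (Subgroup.⊛-absorbʳ N-subgroup (λ x∈N → x∈N))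
    NH : 𝐍 ⊛ 𝐇 ≋ n · 𝐇
    NH = subst (λ m → 𝐍 ⊛ 𝐇 ≋ m · 𝐇) |N|≡n (⊛-absorbʳ N⊆H)
    HN : 𝐇 ⊛ 𝐍 ≋ n · 𝐇
    HN = subst (λ m → 𝐇 ⊛ 𝐍 ≋ m · 𝐇) |N|≡n (⊛-absorbˡ N⊆H)
    XH : 𝐗 ⊛ 𝐇 ≋ k · 𝐇
    XH = subst (λ m → 𝐗 ⊛ 𝐇 ≋ m · 𝐇) |X|≡k (⊛-absorbʳ X⊆H)
    HX′ : 𝐇 ⊛ 𝐗′ ≋ k · 𝐇
    HX′ = subst (λ m → 𝐇 ⊛ 𝐗′ ≋ m · 𝐇) (trans (∣inv∣ X) |X|≡k) (⊛-absorbˡ (inv⊆ X⊆H))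
    HH : 𝐇 ⊛ 𝐇 ≋ (k ℕ.* n) · 𝐇
    HH = subst (λ m → 𝐇 ⊛ 𝐇 ≋ m · 𝐇) index≡m (⊛-absorbʳ (λ x∈H → x∈H))

    D⁽⁻¹⁾≋X′N-H : D ⁽⁻¹⁾ ≋ 𝐗′ ⊛ 𝐍 ⊖ 𝐇
    D⁽⁻¹⁾≋X′N-H = ⊖-cong (≋-trans (⁽⁻¹⁾-⊛ 𝐍 𝐗) (⊛-cong (≋-sym (⟪inv⟫ X)) (Subgroup.⟪H⟫⁽⁻¹⁾ N-subgroup))) ⟪H⟫⁽⁻¹⁾

    NXX′N : 𝐍 ⊛ 𝐗 ⊛ (𝐗′ ⊛ 𝐍) ≋ k · (n · 𝐍) ⊕ l · (n · (n · 𝐇) ⊖ n · (n · 𝐍))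
    NXX′N = begin
      𝐍 ⊛ 𝐗 ⊛ (𝐗′ ⊛ 𝐍)                          ≈⟨ ⊛-assoc (𝐍 ⊛ 𝐗) 𝐗′ 𝐍 ⟨
      𝐍 ⊛ 𝐗 ⊛ 𝐗′ ⊛ 𝐍                            ≈⟨ ⊛-congˡ 𝐍 (≋-trans (⊛-assoc 𝐍 𝐗 𝐗′) (⊛-congʳ 𝐍 equation)) ⟩
      𝐍 ⊛ (k · 𝐞 ⊕ l · (𝐇 ⊖ 𝐍)) ⊛ 𝐍            ≈⟨ ⊛-sandwich 𝐍 𝐍 k l 𝐇 𝐍 ⟩
      k · (𝐍 ⊛ 𝐍) ⊕ l · (𝐍 ⊛ 𝐇 ⊛ 𝐍 ⊖ 𝐍 ⊛ 𝐍 ⊛ 𝐍) ≈⟨ ⊕-cong (·-cong k NN) (·-cong l (⊖-cong (scaled {𝐇} {𝐇} NH HN) (scaled {𝐍} {𝐍} NN NN))) ⟩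
      k · (n · 𝐍) ⊕ l · (n · (n · 𝐇) ⊖ n · (n · 𝐍)) ∎
      where
      open ≋-Reasoning
      scaled : ∀ {a b c} → 𝐍 ⊛ a ≋ n · b → b ⊛ 𝐍 ≋ n · c → 𝐍 ⊛ a ⊛ 𝐍 ≋ n · (n · c)
      scaled {b = b} Na≋nb bN≋nc = ≋-trans (⊛-congˡ 𝐍 Na≋nb) (≋-trans (·-⊛-assoc n b 𝐍) (·-cong n bN≋nc))

    NXH : 𝐍 ⊛ 𝐗 ⊛ 𝐇 ≋ k · (n · 𝐇)
    NXH = ≋-trans (⊛-assoc 𝐍 𝐗 𝐇) (≋-trans (⊛-congʳ 𝐍 XH) (≋-trans (⊛-·-comm k 𝐍 𝐇) (·-cong k NH)))

    HX′N : 𝐇 ⊛ (𝐗′ ⊛ 𝐍) ≋ k · (n · 𝐇)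
    HX′N = ≋-trans (≋-sym (⊛-assoc 𝐇 𝐗′ 𝐍)) (≋-trans (⊛-congˡ 𝐍 HX′) (≋-trans (·-⊛-assoc k 𝐇 𝐍) (·-cong k HN)))

    DD⁽⁻¹⁾≋0 : ∀ g → (D ⊛ D ⁽⁻¹⁾) g ≡ 0ℤ
    DD⁽⁻¹⁾≋0 g = trans (expand g) (transversal-identity n l (𝐍 g) (𝐇 g))
      where
      open ≋-Reasoning
      expand : D ⊛ D ⁽⁻¹⁾ ≋ (k · (n · 𝐍) ⊕ l · (n · (n · 𝐇) ⊖ n · (n · 𝐍)) ⊖ k · (n · 𝐇)) ⊖ (k · (n · 𝐇) ⊖ (k ℕ.* n) · 𝐇)
      expand = begin
        D ⊛ D ⁽⁻¹⁾                                                   ≈⟨ ⊛-congʳ D D⁽⁻¹⁾≋X′N-H ⟩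
        (𝐍 ⊛ 𝐗 ⊖ 𝐇) ⊛ (𝐗′ ⊛ 𝐍 ⊖ 𝐇)                                   ≈⟨ ⊛-distribʳ-⊖ (𝐍 ⊛ 𝐗) 𝐇 (𝐗′ ⊛ 𝐍 ⊖ 𝐇) ⟩
        𝐍 ⊛ 𝐗 ⊛ (𝐗′ ⊛ 𝐍 ⊖ 𝐇) ⊖ 𝐇 ⊛ (𝐗′ ⊛ 𝐍 ⊖ 𝐇)                     ≈⟨ ⊖-cong (⊛-distribˡ-⊖ (𝐍 ⊛ 𝐗) (𝐗′ ⊛ 𝐍) 𝐇) (⊛-distribˡ-⊖ 𝐇 (𝐗′ ⊛ 𝐍) 𝐇) ⟩
        (𝐍 ⊛ 𝐗 ⊛ (𝐗′ ⊛ 𝐍) ⊖ 𝐍 ⊛ 𝐗 ⊛ 𝐇) ⊖ (𝐇 ⊛ (𝐗′ ⊛ 𝐍) ⊖ 𝐇 ⊛ 𝐇)    ≈⟨ ⊖-cong (⊖-cong NXX′N NXH) (⊖-cong HX′N HH) ⟩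
        (k · (n · 𝐍) ⊕ l · (n · (n · 𝐇) ⊖ n · (n · 𝐍)) ⊖ k · (n · 𝐇)) ⊖ (k · (n · 𝐇) ⊖ (k ℕ.* n) · 𝐇) ∎

  ⟪inv⟫⊛⟪inv∘inv⟫ : ∀ X → ⟪ inv 𝔾 X ⟫ ⊛ ⟪ inv 𝔾 (inv 𝔾 X) ⟫ ≋ ⟪ inv 𝔾 X ⟫ ⊛ ⟪ X ⟫
  ⟪inv⟫⊛⟪inv∘inv⟫ X = ⊛-congʳ ⟪ inv 𝔾 X ⟫ (⟪inv∘inv⟫ X)

  inv-rds : ∀ {H N X m n k l} → IsICommuting 𝔾 X → IsRDS 𝔾 H N X m n k l → IsRDS 𝔾 H N (inv 𝔾 X) m n k l
  inv-rds {X = X} X-icomm rds = record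
    { H-subgroup = H-subgroup
    ; N-subgroup = N-subgroup
    ; N⊆H        = N⊆H
    ; X⊆H        = Subgroup.inv⊆ H-subgroup X⊆H
    ; |N|≡n      = |N|≡n
    ; index≡m    = index≡m
    ; |X|≡k      = trans (∣inv∣ X) |X|≡k
    ; l-pos      = l-pos
    ; equation   = ≋-trans (⟪inv⟫⊛⟪inv∘inv⟫ X) (≋-trans (≋-sym X-icomm) equation)
    }
    where open IsRDS rds

  -- Off H the right-hand side equals −l at the points of N′, but A B has nonnegative coefficients.
  forbidden⊆ : ∀ {A B H N′ k l} → IsSubgroup 𝔾 H → 0 ℕ.< l →
               ⟪ A ⟫ ⊛ ⟪ B ⟫ ≋ k · 𝐞 ⊕ l · (⟪ H ⟫ ⊖ ⟪ N′ ⟫) → N′ ⊆ H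
  forbidden⊆ {A} {B} {H} {N′} {k} {suc l} H≤G _ AB≋ {x} x∈N′ with lookup H x in x∈?H
  ... | true  = Vecₚ.lookup⇒[]= x H x∈?H
  ... | false = ⊥-elim (0≰-[1+l] (subst (0ℤ ≤_) value (⟪⟫⊛⟪⟫-nonneg A B x)))
    where
    0≰-[1+l] : ¬ 0ℤ ≤ -[1+ l ]
    0≰-[1+l] ()
    false≢true : false ≢ true
    false≢true ()
    x≢ε : x ≢ ε
    x≢ε x≡ε = false≢true (trans (sym x∈?H) (trans (cong (lookup H) x≡ε) (Vecₚ.[]=⇒lookup (IsSubgroup.ε∈ H≤G))))
    a0+b[0-1]≡-b : ∀ a b → a * 0ℤ + b * (0ℤ - 1ℤ) ≡ - b
    a0+b[0-1]≡-b = solve-∀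
    value : (⟪ A ⟫ ⊛ ⟪ B ⟫) x ≡ -[1+ l ]
    value = begin
      (⟪ A ⟫ ⊛ ⟪ B ⟫) x                                  ≡⟨ AB≋ x ⟩
      + k * 𝐞 x + + suc l * (𝟙 (lookup H x) - ⟪ N′ ⟫ x)  ≡⟨ cong₂ (λ u v → + k * u + + suc l * (𝟙 v - ⟪ N′ ⟫ x)) (𝐞-≢ε x≢ε) x∈?H ⟩
      + k * 0ℤ + + suc l * (0ℤ - ⟪ N′ ⟫ x)               ≡⟨ cong (λ v → + k * 0ℤ + + suc l * (0ℤ - v)) (∈⇒𝟙≡1 x∈N′) ⟩
      + k * 0ℤ + + suc l * (0ℤ - 1ℤ)                     ≡⟨ a0+b[0-1]≡-b (+ k) (+ suc l) ⟩
      -[1+ l ]                                           ∎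
      where open ≡-Reasoning

  icommuting-rds⇒X⊛N≋H : ∀ {H N X n l} → IsICommuting 𝔾 X → IsRDS 𝔾 H N X (n ℕ.* l) n (n ℕ.* l) l →
                          ⟪ X ⟫ ⊛ ⟪ N ⟫ ≋ ⟪ H ⟫
  icommuting-rds⇒X⊛N≋H {H} {N} {X} X-icomm rds g = begin
    (⟪ X ⟫ ⊛ ⟪ N ⟫) g                          ≡⟨ ⊛-cong (≋-sym (⟪inv∘inv⟫ X)) (≋-sym (Subgroup.⟪H⟫⁽⁻¹⁾ N-subgroup)) g ⟩
    (⟪ inv 𝔾 (inv 𝔾 X) ⟫ ⊛ ⟪ N ⟫ ⁽⁻¹⁾) g       ≡⟨ ⊛-congˡ (⟪ N ⟫ ⁽⁻¹⁾) (⟪inv⟫ (inv 𝔾 X)) g ⟩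
    (⟪ inv 𝔾 X ⟫ ⁽⁻¹⁾ ⊛ ⟪ N ⟫ ⁽⁻¹⁾) g          ≡⟨ ⁽⁻¹⁾-⊛ ⟪ N ⟫ ⟪ inv 𝔾 X ⟫ g ⟨
    (⟪ N ⟫ ⊛ ⟪ inv 𝔾 X ⟫) (g ⁻¹)               ≡⟨ rds⇒transversal (inv-rds X-icomm rds) (g ⁻¹) ⟩
    ⟪ H ⟫ (g ⁻¹)                               ≡⟨ Subgroup.⟪H⟫⁽⁻¹⁾ H-subgroup g ⟩
    ⟪ H ⟫ g                                    ∎
    where
    open IsRDS rds
    open ≡-Reasoning

module ProductConstruction
  (𝔾 : FinGroup) (G₁ G₂ X₁ X₂ : Sub 𝔾) (n λ₁ λ₂ : ℕ)
  (G₁≤G : IsSubgroup 𝔾 G₁) (G₂≤G : IsSubgroup 𝔾 G₂)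
  (G≡G₁G₂ : ∀ g → Σ (Elt 𝔾) λ a → Σ (Elt 𝔾) λ b → a ∈ G₁ × b ∈ G₂ × g ≡ FinGroup._∙_ 𝔾 a b)
  (rds₁ : IsRDS 𝔾 G₁ (G₁ ∩ G₂) X₁ (n ℕ.* λ₁) n (n ℕ.* λ₁) λ₁)
  (rds₂ : IsRDS 𝔾 G₂ (G₁ ∩ G₂) X₂ (n ℕ.* λ₂) n (n ℕ.* λ₂) λ₂)
  (X₁-icomm : IsICommuting 𝔾 X₁)
  where

  open ℤ using (+_; 1ℤ; _+_; _*_; _-_)
  open IntegerSums
  open FinGroup 𝔾
  open GroupRing 𝔾
  open RelativeDifferenceSets 𝔾

  N X : Sub 𝔾
  N = G₁ ∩ G₂
  X = prodSet 𝔾 X₁ X₂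

  k₁ k₂ K Λ : ℕ
  k₁ = n ℕ.* λ₁
  k₂ = n ℕ.* λ₂
  K = n ℕ.* n ℕ.* λ₁ ℕ.* λ₂
  Λ = n ℕ.* λ₁ ℕ.* λ₂

  𝐍 𝐆₁ 𝐆₂ 𝐗₁ 𝐗₂ 𝐗₁′ 𝐗₂′ 𝟏 P Q : ℤ[G]
  𝐍 = ⟪ N ⟫
  𝐆₁ = ⟪ G₁ ⟫
  𝐆₂ = ⟪ G₂ ⟫
  𝐗₁ = ⟪ X₁ ⟫
  𝐗₂ = ⟪ X₂ ⟫
  𝐗₁′ = ⟪ inv 𝔾 X₁ ⟫
  𝐗₂′ = ⟪ inv 𝔾 X₂ ⟫
  𝟏 = ⟪ ⊤ ⟫
  P = 𝐗₁ ⊛ 𝐗₂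
  Q = 𝐗₂′ ⊛ 𝐗₂

  open IsRDS rds₁ using () renaming (N-subgroup to N≤G; |N|≡n to |N|≡n; equation to X₁X₁′≋)
  open IsRDS rds₂ using () renaming (equation to X₂X₂′≋)

  instance
    n≢0 : ℕ.NonZero n
    n≢0 = ℕ.>-nonZero (subst (0 ℕ.<_) |N|≡n (∣H∣>0 N≤G))
    k₁≢0 : ℕ.NonZero k₁
    k₁≢0 = ℕₚ.m*n≢0 n λ₁ {{n≢0}} {{ℕ.>-nonZero (IsRDS.l-pos rds₁)}}

  NX₁ : 𝐍 ⊛ 𝐗₁ ≋ 𝐆₁
  NX₁ = rds⇒transversal rds₁

  NX₂ : 𝐍 ⊛ 𝐗₂ ≋ 𝐆₂
  NX₂ = rds⇒transversal rds₂

  X₁N : 𝐗₁ ⊛ 𝐍 ≋ 𝐆₁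
  X₁N = icommuting-rds⇒X⊛N≋H X₁-icomm rds₁

  G₁G₂ : 𝐆₁ ⊛ 𝐆₂ ≋ n · 𝟏
  G₁G₂ = subst (λ m → 𝐆₁ ⊛ 𝐆₂ ≋ m · 𝟏) |N|≡n (⊛-factorisation G₁≤G G₂≤G G≡G₁G₂)

  X₁G₂ : 𝐗₁ ⊛ 𝐆₂ ≋ 𝟏
  X₁G₂ = ·-cancelˡ n (begin
    n · (𝐗₁ ⊛ 𝐆₂)    ≈⟨ ⊛-·-comm n 𝐗₁ 𝐆₂ ⟨
    𝐗₁ ⊛ (n · 𝐆₂)    ≈⟨ ⊛-congʳ 𝐗₁ NG₂ ⟨
    𝐗₁ ⊛ (𝐍 ⊛ 𝐆₂)    ≈⟨ ⊛-assoc 𝐗₁ 𝐍 𝐆₂ ⟨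
    𝐗₁ ⊛ 𝐍 ⊛ 𝐆₂      ≈⟨ ⊛-congˡ 𝐆₂ X₁N ⟩
    𝐆₁ ⊛ 𝐆₂          ≈⟨ G₁G₂ ⟩
    n · 𝟏            ∎)
    where
    open ≋-Reasoning
    NG₂ : 𝐍 ⊛ 𝐆₂ ≋ n · 𝐆₂
    NG₂ = subst (λ m → 𝐍 ⊛ 𝐆₂ ≋ m · 𝐆₂) |N|≡n (Subgroup.⊛-absorbʳ G₂≤G (Subsetₚ.p∩q⊆q G₁ G₂))

  G₁X₂ : 𝐆₁ ⊛ 𝐗₂ ≋ 𝟏
  G₁X₂ = ·-cancelˡ n (begin
    n · (𝐆₁ ⊛ 𝐗₂)    ≈⟨ ·-⊛-assoc n 𝐆₁ 𝐗₂ ⟨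
    n · 𝐆₁ ⊛ 𝐗₂      ≈⟨ ⊛-congˡ 𝐗₂ G₁N ⟨
    𝐆₁ ⊛ 𝐍 ⊛ 𝐗₂      ≈⟨ ⊛-assoc 𝐆₁ 𝐍 𝐗₂ ⟩
    𝐆₁ ⊛ (𝐍 ⊛ 𝐗₂)    ≈⟨ ⊛-congʳ 𝐆₁ NX₂ ⟩
    𝐆₁ ⊛ 𝐆₂          ≈⟨ G₁G₂ ⟩
    n · 𝟏            ∎)
    where
    open ≋-Reasoning
    G₁N : 𝐆₁ ⊛ 𝐍 ≋ n · 𝐆₁
    G₁N = subst (λ m → 𝐆₁ ⊛ 𝐍 ≋ m · 𝐆₁) |N|≡n (Subgroup.⊛-absorbˡ G₁≤G (Subsetₚ.p∩q⊆p G₁ G₂))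

  +k₁ : + k₁ ≡ + n * + λ₁
  +k₁ = ℤₚ.pos-* n λ₁

  +k₂ : + k₂ ≡ + n * + λ₂
  +k₂ = ℤₚ.pos-* n λ₂

  +K : + K ≡ + n * + n * + λ₁ * + λ₂
  +K = trans (ℤₚ.pos-* (n ℕ.* n ℕ.* λ₁) λ₂) (cong (_* + λ₂) (pos-*³ n n λ₁))

  +Λ : + Λ ≡ + n * + λ₁ * + λ₂
  +Λ = pos-*³ n λ₁ λ₂

  PP⁽⁻¹⁾-identity : ∀ e o g m →
    + k₂ * (+ k₁ * e + + λ₁ * (g - m)) + + λ₂ * (+ k₁ * o - + k₁ * g) ≡ + K * e + + Λ * (o - m)
  PP⁽⁻¹⁾-identity e o g m = begin
    + k₂ * (+ k₁ * e + + λ₁ * (g - m)) + + λ₂ * (+ k₁ * o - + k₁ * g)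
      ≡⟨ cong₂ (λ a b → b * (a * e + + λ₁ * (g - m)) + + λ₂ * (a * o - a * g)) +k₁ +k₂ ⟩
    + n * + λ₂ * (+ n * + λ₁ * e + + λ₁ * (g - m)) + + λ₂ * (+ n * + λ₁ * o - + n * + λ₁ * g)
      ≡⟨ ring (+ n) (+ λ₁) (+ λ₂) e o g m ⟩
    + n * + n * + λ₁ * + λ₂ * e + + n * + λ₁ * + λ₂ * (o - m)
      ≡⟨ cong₂ (λ a b → a * e + b * (o - m)) +K +Λ ⟨
    + K * e + + Λ * (o - m) ∎
    where
    open ≡-Reasoning
    ring : ∀ n a b e o g m → n * b * (n * a * e + a * (g - m)) + b * (n * a * o - n * a * g)
                             ≡ n * n * a * b * e + n * a * b * (o - m)
    ring = solve-∀

  P⁽⁻¹⁾P-identity : ∀ e o g m →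
    + k₁ * (+ k₂ * e + + λ₂ * (g - m)) + + λ₁ * (+ k₂ * o - + k₂ * g) ≡ + K * e + + Λ * (o - m)
  P⁽⁻¹⁾P-identity e o g m = begin
    + k₁ * (+ k₂ * e + + λ₂ * (g - m)) + + λ₁ * (+ k₂ * o - + k₂ * g)
      ≡⟨ cong₂ (λ a b → a * (b * e + + λ₂ * (g - m)) + + λ₁ * (b * o - b * g)) +k₁ +k₂ ⟩
    + n * + λ₁ * (+ n * + λ₂ * e + + λ₂ * (g - m)) + + λ₁ * (+ n * + λ₂ * o - + n * + λ₂ * g)
      ≡⟨ ring (+ n) (+ λ₁) (+ λ₂) e o g m ⟩
    + n * + n * + λ₁ * + λ₂ * e + + n * + λ₁ * + λ₂ * (o - m)
      ≡⟨ cong₂ (λ a b → a * e + b * (o - m)) +K +Λ ⟨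
    + K * e + + Λ * (o - m) ∎
    where
    open ≡-Reasoning
    ring : ∀ n a b e o g m → n * a * (n * b * e + b * (g - m)) + a * (n * b * o - n * b * g)
                             ≡ n * n * a * b * e + n * a * b * (o - m)
    ring = solve-∀

  P⁽⁻¹⁾≋X₂′X₁′ : P ⁽⁻¹⁾ ≋ 𝐗₂′ ⊛ 𝐗₁′
  P⁽⁻¹⁾≋X₂′X₁′ = ≋-trans (⁽⁻¹⁾-⊛ 𝐗₁ 𝐗₂) (⊛-cong (≋-sym (⟪inv⟫ X₂)) (≋-sym (⟪inv⟫ X₁)))

  |X₁′| : ∣ inv 𝔾 X₁ ∣ ≡ k₁
  |X₁′| = trans (∣inv∣ X₁) (IsRDS.|X|≡k rds₁)

  |X₂′| : ∣ inv 𝔾 X₂ ∣ ≡ k₂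
  |X₂′| = trans (∣inv∣ X₂) (IsRDS.|X|≡k rds₂)

  PP⁽⁻¹⁾ : P ⊛ P ⁽⁻¹⁾ ≋ K · 𝐞 ⊕ Λ · (𝟏 ⊖ 𝐍)
  PP⁽⁻¹⁾ = begin
    P ⊛ P ⁽⁻¹⁾                                              ≈⟨ ⊛-congʳ P P⁽⁻¹⁾≋X₂′X₁′ ⟩
    𝐗₁ ⊛ 𝐗₂ ⊛ (𝐗₂′ ⊛ 𝐗₁′)                                   ≈⟨ ⊛-assoc P 𝐗₂′ 𝐗₁′ ⟨
    𝐗₁ ⊛ 𝐗₂ ⊛ 𝐗₂′ ⊛ 𝐗₁′                                     ≈⟨ ⊛-congˡ 𝐗₁′ (≋-trans (⊛-assoc 𝐗₁ 𝐗₂ 𝐗₂′) (⊛-congʳ 𝐗₁ X₂X₂′≋)) ⟩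
    𝐗₁ ⊛ (k₂ · 𝐞 ⊕ λ₂ · (𝐆₂ ⊖ 𝐍)) ⊛ 𝐗₁′                    ≈⟨ ⊛-sandwich 𝐗₁ 𝐗₁′ k₂ λ₂ 𝐆₂ 𝐍 ⟩
    k₂ · (𝐗₁ ⊛ 𝐗₁′) ⊕ λ₂ · (𝐗₁ ⊛ 𝐆₂ ⊛ 𝐗₁′ ⊖ 𝐗₁ ⊛ 𝐍 ⊛ 𝐗₁′) ≈⟨ ⊕-cong (·-cong k₂ X₁X₁′≋) (·-cong λ₂ (⊖-cong X₁G₂X₁′ X₁NX₁′)) ⟩
    k₂ · (k₁ · 𝐞 ⊕ λ₁ · (𝐆₁ ⊖ 𝐍)) ⊕ λ₂ · (k₁ · 𝟏 ⊖ k₁ · 𝐆₁) ≈⟨ (λ g → PP⁽⁻¹⁾-identity (𝐞 g) (𝟏 g) (𝐆₁ g) (𝐍 g)) ⟩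
    K · 𝐞 ⊕ Λ · (𝟏 ⊖ 𝐍)                                     ∎
    where
    open ≋-Reasoning
    X₁G₂X₁′ : 𝐗₁ ⊛ 𝐆₂ ⊛ 𝐗₁′ ≋ k₁ · 𝟏
    X₁G₂X₁′ = ≋-trans (⊛-congˡ 𝐗₁′ X₁G₂)
      (subst (λ m → 𝟏 ⊛ 𝐗₁′ ≋ m · 𝟏) |X₁′| (Subgroup.⊛-absorbˡ ⊤≤G {inv 𝔾 X₁} (λ _ → Subsetₚ.∈⊤)))
    X₁NX₁′ : 𝐗₁ ⊛ 𝐍 ⊛ 𝐗₁′ ≋ k₁ · 𝐆₁
    X₁NX₁′ = ≋-trans (⊛-congˡ 𝐗₁′ X₁N)
      (subst (λ m → 𝐆₁ ⊛ 𝐗₁′ ≋ m · 𝐆₁) |X₁′| (Subgroup.⊛-absorbˡ G₁≤G (Subgroup.inv⊆ G₁≤G (IsRDS.X⊆H rds₁))))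

  Φ : ℤ[G] → ℤ[G]
  Φ q = k₁ · q ⊕ λ₁ · (k₂ · 𝟏 ⊖ k₂ · 𝐆₂)

  X₂′X₁′P≋ΦQ : 𝐗₂′ ⊛ 𝐗₁′ ⊛ P ≋ Φ Q
  X₂′X₁′P≋ΦQ = begin
    𝐗₂′ ⊛ 𝐗₁′ ⊛ (𝐗₁ ⊛ 𝐗₂)                                   ≈⟨ ⊛-assoc (𝐗₂′ ⊛ 𝐗₁′) 𝐗₁ 𝐗₂ ⟨
    𝐗₂′ ⊛ 𝐗₁′ ⊛ 𝐗₁ ⊛ 𝐗₂                                     ≈⟨ ⊛-congˡ 𝐗₂ (≋-trans (⊛-assoc 𝐗₂′ 𝐗₁′ 𝐗₁) (⊛-congʳ 𝐗₂′ X₁′X₁≋)) ⟩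
    𝐗₂′ ⊛ (k₁ · 𝐞 ⊕ λ₁ · (𝐆₁ ⊖ 𝐍)) ⊛ 𝐗₂                    ≈⟨ ⊛-sandwich 𝐗₂′ 𝐗₂ k₁ λ₁ 𝐆₁ 𝐍 ⟩
    k₁ · Q ⊕ λ₁ · (𝐗₂′ ⊛ 𝐆₁ ⊛ 𝐗₂ ⊖ 𝐗₂′ ⊛ 𝐍 ⊛ 𝐗₂)           ≈⟨ ⊕-cong (≋-refl {k₁ · Q}) (·-cong λ₁ (⊖-cong X₂′G₁X₂ X₂′NX₂)) ⟩
    Φ Q                                                     ∎
    where
    open ≋-Reasoning
    X₁′X₁≋ : 𝐗₁′ ⊛ 𝐗₁ ≋ k₁ · 𝐞 ⊕ λ₁ · (𝐆₁ ⊖ 𝐍)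
    X₁′X₁≋ = ≋-trans (≋-sym X₁-icomm) X₁X₁′≋
    X₂′G₁X₂ : 𝐗₂′ ⊛ 𝐆₁ ⊛ 𝐗₂ ≋ k₂ · 𝟏
    X₂′G₁X₂ = ≋-trans (⊛-assoc 𝐗₂′ 𝐆₁ 𝐗₂) (≋-trans (⊛-congʳ 𝐗₂′ G₁X₂)
      (subst (λ m → 𝐗₂′ ⊛ 𝟏 ≋ m · 𝟏) |X₂′| (Subgroup.⊛-absorbʳ ⊤≤G {inv 𝔾 X₂} (λ _ → Subsetₚ.∈⊤))))
    X₂′NX₂ : 𝐗₂′ ⊛ 𝐍 ⊛ 𝐗₂ ≋ k₂ · 𝐆₂
    X₂′NX₂ = ≋-trans (⊛-assoc 𝐗₂′ 𝐍 𝐗₂) (≋-trans (⊛-congʳ 𝐗₂′ NX₂)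
      (subst (λ m → 𝐗₂′ ⊛ 𝐆₂ ≋ m · 𝐆₂) |X₂′| (Subgroup.⊛-absorbʳ G₂≤G (Subgroup.inv⊆ G₂≤G (IsRDS.X⊆H rds₂)))))

  ∑P≡K : ∑ P ≡ + K
  ∑P≡K = begin
    ∑ (𝐗₁ ⊛ 𝐗₂)                   ≡⟨ ∑-⊛ 𝐗₁ 𝐗₂ ⟩
    ∑ 𝐗₁ * ∑ 𝐗₂                   ≡⟨ cong₂ _*_ (trans (∑⟪⟫ X₁) (cong +_ (IsRDS.|X|≡k rds₁))) (trans (∑⟪⟫ X₂) (cong +_ (IsRDS.|X|≡k rds₂))) ⟩
    + k₁ * + k₂                   ≡⟨ cong₂ _*_ +k₁ +k₂ ⟩
    + n * + λ₁ * (+ n * + λ₂)     ≡⟨ ring (+ n) (+ λ₁) (+ λ₂) ⟩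
    + n * + n * + λ₁ * + λ₂       ≡⟨ +K ⟨
    + K                           ∎
    where
    open ≡-Reasoning
    ring : ∀ n a b → n * a * (n * b) ≡ n * n * a * b
    ring = solve-∀

  ∑P²≡K : ∑ (λ g → P g * P g) ≡ + K
  ∑P²≡K = begin
    ∑ (λ g → P g * P g)               ≡⟨ ⊛⁽⁻¹⁾-at-ε P ⟨
    (P ⊛ P ⁽⁻¹⁾) ε                    ≡⟨ PP⁽⁻¹⁾ ε ⟩
    + K * 𝐞 ε + + Λ * (𝟏 ε - 𝐍 ε)     ≡⟨ cong₂ (λ u v → + K * u + + Λ * v) 𝐞-ε (cong₂ _-_ (⟪⊤⟫ ε) (∈⇒𝟙≡1 (IsSubgroup.ε∈ N≤G))) ⟩
    + K * 1ℤ + + Λ * (1ℤ - 1ℤ)        ≡⟨ ring (+ K) (+ Λ) ⟩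
    + K                               ∎
    where
    open ≡-Reasoning
    ring : ∀ a b → a * 1ℤ + b * (1ℤ - 1ℤ) ≡ a
    ring = solve-∀

  ⟪X⟫≋P : ⟪ X ⟫ ≋ P
  ⟪X⟫≋P g = ⟪prodSet⟫ X₁ X₂ g (sum-sq≡sum⇒01 P (⟪⟫⊛⟪⟫-nonneg X₁ X₂) (trans ∑P²≡K (sym ∑P≡K)) g)

  |X|≡K : ∣ X ∣ ≡ K
  |X|≡K = ℤₚ.+-injective (trans (sym (∑⟪⟫ X)) (trans (sum-cong-≗ ⟪X⟫≋P) ∑P≡K))

  ∣G∣≡K*n : ∣ ⊤ {order} ∣ ≡ K ℕ.* n
  ∣G∣≡K*n = ℤₚ.+-injective (begin
    + ∣ ⊤ {order} ∣                      ≡⟨ ∑⟪⟫ ⊤ ⟨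
    ∑ 𝟏                                  ≡⟨ sum-cong-≗ G₁X₂ ⟨
    ∑ (𝐆₁ ⊛ 𝐗₂)                          ≡⟨ ∑-⊛ 𝐆₁ 𝐗₂ ⟩
    ∑ 𝐆₁ * ∑ 𝐗₂                          ≡⟨ cong₂ _*_ (trans (∑⟪⟫ G₁) (cong +_ (IsRDS.index≡m rds₁))) (trans (∑⟪⟫ X₂) (cong +_ (IsRDS.|X|≡k rds₂))) ⟩
    + (k₁ ℕ.* n) * + k₂                  ≡⟨ cong₂ _*_ (pos-*³ n λ₁ n) +k₂ ⟩
    + n * + λ₁ * + n * (+ n * + λ₂)      ≡⟨ ring (+ n) (+ λ₁) (+ λ₂) ⟩
    + n * + n * + λ₁ * + λ₂ * + n        ≡⟨ cong (_* + n) +K ⟨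
    + K * + n                            ≡⟨ ℤₚ.pos-* K n ⟨
    + (K ℕ.* n)                          ∎)
    where
    open ≡-Reasoning
    ring : ∀ n a b → n * a * n * (n * b) ≡ n * n * a * b * n
    ring = solve-∀

  Λ>0 : 0 ℕ.< Λ
  Λ>0 = ℕ.>-nonZero⁻¹ Λ {{ℕₚ.m*n≢0 k₁ λ₂ {{k₁≢0}} {{ℕ.>-nonZero (IsRDS.l-pos rds₂)}}}}

  X-rds : IsRDS 𝔾 ⊤ N X K n K Λ
  X-rds = record
    { H-subgroup = ⊤≤G
    ; N-subgroup = N≤G
    ; N⊆H        = λ _ → Subsetₚ.∈⊤
    ; X⊆H        = λ _ → Subsetₚ.∈⊤
    ; |N|≡n      = |N|≡n
    ; index≡m    = ∣G∣≡K*n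
    ; |X|≡k      = |X|≡K
    ; l-pos      = Λ>0
    ; equation   = ≋-trans (⊛-cong ⟪X⟫≋P (≋-trans (⟪inv⟫ X) (λ g → ⟪X⟫≋P (g ⁻¹)))) PP⁽⁻¹⁾
    }

  X-semiregular : IsSemiregular 𝔾 ⊤ N X
  X-semiregular = transversal⇒semiregular {X = X} N≤G (begin
    𝐍 ⊛ ⟪ X ⟫      ≈⟨ ⊛-congʳ 𝐍 ⟪X⟫≋P ⟩
    𝐍 ⊛ P          ≈⟨ ⊛-assoc 𝐍 𝐗₁ 𝐗₂ ⟨
    𝐍 ⊛ 𝐗₁ ⊛ 𝐗₂    ≈⟨ ⊛-congˡ 𝐗₂ NX₁ ⟩
    𝐆₁ ⊛ 𝐗₂        ≈⟨ G₁X₂ ⟩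
    𝟏              ∎)
    where open ≋-Reasoning

  X⁽⁻¹⁾-lhs≋ΦQ : ⟪ inv 𝔾 X ⟫ ⊛ ⟪ inv 𝔾 (inv 𝔾 X) ⟫ ≋ Φ Q
  X⁽⁻¹⁾-lhs≋ΦQ = begin
    ⟪ inv 𝔾 X ⟫ ⊛ ⟪ inv 𝔾 (inv 𝔾 X) ⟫    ≈⟨ ⊛-cong (⟪inv⟫ X) (⟪inv∘inv⟫ X) ⟩
    ⟪ X ⟫ ⁽⁻¹⁾ ⊛ ⟪ X ⟫                    ≈⟨ ⊛-cong (≋-trans (λ g → ⟪X⟫≋P (g ⁻¹)) P⁽⁻¹⁾≋X₂′X₁′) ⟪X⟫≋P ⟩
    𝐗₂′ ⊛ 𝐗₁′ ⊛ P                        ≈⟨ X₂′X₁′P≋ΦQ ⟩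
    Φ Q                                  ∎
    where open ≋-Reasoning

  Φ-rds-equation : ∀ N′ → Φ (k₂ · 𝐞 ⊕ λ₂ · (𝐆₂ ⊖ ⟪ N′ ⟫)) ≋ K · 𝐞 ⊕ Λ · (𝟏 ⊖ ⟪ N′ ⟫)
  Φ-rds-equation N′ g = P⁽⁻¹⁾P-identity (𝐞 g) (𝟏 g) (𝐆₂ g) (⟪ N′ ⟫ g)

  Φ-injective : ∀ {q r} → Φ q ≋ Φ r → q ≋ r
  Φ-injective Φq≋Φr = ·-cancelˡ k₁ (λ g → +-cancelʳ ((λ₁ · (k₂ · 𝟏 ⊖ k₂ · 𝐆₂)) g) _ _ (Φq≋Φr g))
    where open GroupProperties (AbelianGroup.group ℤₚ.+-0-abelianGroup) using () renaming (∙-cancelʳ to +-cancelʳ)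

  inv-X-rds⇔inv-X₂-rds : ∀ N′ → IsRDS 𝔾 ⊤ N′ (inv 𝔾 X) K n K Λ ⇔ IsRDS 𝔾 G₂ N′ (inv 𝔾 X₂) k₂ n k₂ λ₂
  inv-X-rds⇔inv-X₂-rds N′ = mk⇔ to from
    where
    to : IsRDS 𝔾 ⊤ N′ (inv 𝔾 X) K n K Λ → IsRDS 𝔾 G₂ N′ (inv 𝔾 X₂) k₂ n k₂ λ₂
    to rds′ = record
      { H-subgroup = G₂≤G
      ; N-subgroup = IsRDS.N-subgroup rds′
      ; N⊆H        = forbidden⊆ {inv 𝔾 X₂} {inv 𝔾 (inv 𝔾 X₂)} {k = k₂} G₂≤G (IsRDS.l-pos rds₂) equation₂
      ; X⊆H        = Subgroup.inv⊆ G₂≤G (IsRDS.X⊆H rds₂)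
      ; |N|≡n      = IsRDS.|N|≡n rds′
      ; index≡m    = IsRDS.index≡m rds₂
      ; |X|≡k      = |X₂′|
      ; l-pos      = IsRDS.l-pos rds₂
      ; equation   = equation₂
      }
      where
      equation₂ : ⟪ inv 𝔾 X₂ ⟫ ⊛ ⟪ inv 𝔾 (inv 𝔾 X₂) ⟫ ≋ k₂ · 𝐞 ⊕ λ₂ · (𝐆₂ ⊖ ⟪ N′ ⟫)
      equation₂ = ≋-trans (⟪inv⟫⊛⟪inv∘inv⟫ X₂) (Φ-injective (≋-trans (≋-sym X⁽⁻¹⁾-lhs≋ΦQ)
        (≋-trans (IsRDS.equation rds′) (≋-sym (Φ-rds-equation N′)))))

    from : IsRDS 𝔾 G₂ N′ (inv 𝔾 X₂) k₂ n k₂ λ₂ → IsRDS 𝔾 ⊤ N′ (inv 𝔾 X) K n K Λ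
    from rds₂′ = record
      { H-subgroup = ⊤≤G
      ; N-subgroup = IsRDS.N-subgroup rds₂′
      ; N⊆H        = λ _ → Subsetₚ.∈⊤
      ; X⊆H        = λ _ → Subsetₚ.∈⊤
      ; |N|≡n      = IsRDS.|N|≡n rds₂′
      ; index≡m    = ∣G∣≡K*n
      ; |X|≡k      = trans (∣inv∣ X) |X|≡K
      ; l-pos      = Λ>0
      ; equation   = ≋-trans X⁽⁻¹⁾-lhs≋ΦQ (≋-trans (⊕-cong (·-cong k₁ Q≋) (≋-refl {λ₁ · (k₂ · 𝟏 ⊖ k₂ · 𝐆₂)}))
                       (Φ-rds-equation N′))
      }
      where
      Q≋ : Q ≋ k₂ · 𝐞 ⊕ λ₂ · (𝐆₂ ⊖ ⟪ N′ ⟫)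
      Q≋ = ≋-trans (≋-sym (⟪inv⟫⊛⟪inv∘inv⟫ X₂)) (IsRDS.equation rds₂′)

  X-symmetric⇔X₂-symmetric : IsSymmetricRDS 𝔾 ⊤ N X K n K Λ ⇔ IsSymmetricRDS 𝔾 G₂ N X₂ k₂ n k₂ λ₂
  X-symmetric⇔X₂-symmetric = mk⇔
    (λ (_ , N′ , rds′) → rds₂ , N′ , Equivalence.to (inv-X-rds⇔inv-X₂-rds N′) rds′)
    (λ (_ , N′ , rds₂′) → X-rds , N′ , Equivalence.from (inv-X-rds⇔inv-X₂-rds N′) rds₂′)

open import Data.Nat using (_*_)

proposition3p3 : (𝔾 : FinGroup) (G₁ G₂ X₁ X₂ : Sub 𝔾) (n λ₁ λ₂ : ℕ)
    → IsSubgroup 𝔾 G₁ → IsSubgroup 𝔾 G₂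
    → IsProper 𝔾 G₁ → IsProper 𝔾 G₂
    → (∀ g → Σ (Elt 𝔾) λ a → Σ (Elt 𝔾) λ b → a ∈ G₁ × b ∈ G₂ × g ≡ FinGroup._∙_ 𝔾 a b)
    → IsSemiregularRDS 𝔾 G₁ (G₁ ∩ G₂) X₁ (n * λ₁) n (n * λ₁) λ₁
    → IsSemiregularRDS 𝔾 G₂ (G₁ ∩ G₂) X₂ (n * λ₂) n (n * λ₂) λ₂
    → IsICommuting 𝔾 X₁
    → IsSemiregularRDS 𝔾 ⊤ (G₁ ∩ G₂) (prodSet 𝔾 X₁ X₂)
        (n * n * λ₁ * λ₂) n (n * n * λ₁ * λ₂) (n * λ₁ * λ₂)
      × (IsSymmetricRDS 𝔾 ⊤ (G₁ ∩ G₂) (prodSet 𝔾 X₁ X₂)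
           (n * n * λ₁ * λ₂) n (n * n * λ₁ * λ₂) (n * λ₁ * λ₂)
         ⇔ IsSymmetricRDS 𝔾 G₂ (G₁ ∩ G₂) X₂ (n * λ₂) n (n * λ₂) λ₂)
proposition3p3 𝔾 G₁ G₂ X₁ X₂ n λ₁ λ₂ G₁≤G G₂≤G _ _ G≡G₁G₂ (rds₁ , _) (rds₂ , _) X₁-icomm =
  (X-rds , X-semiregular) , X-symmetric⇔X₂-symmetric
  where open ProductConstruction 𝔾 G₁ G₂ X₁ X₂ n λ₁ λ₂ G₁≤G G₂≤G G≡G₁G₂ rds₁ rds₂ X₁-icomm
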